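{- Let $(M_n)_{n\ge1}$, $M_n=(f_n(m,k))$, be the Delta sequence. For $p\ge0$ define the infinite matrix $\Lambda^{(p)}=(\lambda^{(p)}_{i,j})_{i,j\ge0}$ by $\lambda^{(p)}_{i,j}=0$ if $i+j\equiv p\pmod 2$, and $\lambda^{(p)}_{i,j}=f_n(m,k)$ with $k=j+1$, $m=i+j+2$, $2n=p+i+j+1$ if $i+j\equiv p+1\pmod2$. Then every $\Lambda^{(p)}$ ($p\ge0$) is a Poupard matrix, i.e. $\lambda^{(p)}_{i,j+2}-2\lambda^{(p)}_{i+1,j+1}+\lambda^{(p)}_{i+2,j}+2\lambda^{(p)}_{i,j}=0$ for all $i,j\ge0$.
   Context: Delta sequence. For $n\ge1$, $M_n=(f_n(m,k))_{1\le m,k\le 2n}$ is a $2n\times 2n$ matrix; by convention $f_n(m,k)=0$ if $(m,k)\notin[1,2n]^2$. Write $f_n(m,\bullet)=\sum_{k=1}^{2n}f_n(m,k)$ and $f_n(\bullet,k)=\sum_{m=1}^{2n}f_n(m,k)$. Let $L_n^{(1)}=\{(m,k):2\le k+1\le m\le 2n-2\}$ and $U_n^{(1)}=\{(m,k):2\le m+1\le k\le 2n-2\}$. The Delta sequence is the unique sequence $(M_n)_{n\ge1}$ of matrices with nonnegative integer entries such that $M_1=\begin{pmatrix}0&0\\1&0\end{pmatrix}$ and, for every $n\ge2$: (a) $f_n(m,m)=0$ for all $m$; (b) $f_n(m+2,k)-2f_n(m+1,k)+f_n(m,k)+2f_{n-1}(m,k)=0$ for $(m,k)\in L_n^{(1)}$;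 (c) $f_n(m,k+2)-2f_n(m,k+1)+f_n(m,k)+2f_{n-1}(m,k)=0$ for $(m,k)\in U_n^{(1)}$; (d) column $2n$ of $M_n$ is zero, and column $2n-1$ is $(f_{n-1}(1,\bullet),\dots,f_{n-1}(2n-2,\bullet),0,0)$ read top to bottom; (e) row $2n$ of $M_n$ is $(f_{n-1}(1,\bullet),\dots,f_{n-1}(2n-2,\bullet),0,0)$ read left to right, and row $2n-1$ is $(f_{n-1}(1,\bullet)+f_{n-1}(\bullet,1),\dots,f_{n-1}(2n-2,\bullet)+f_{n-1}(\bullet,2n-2),0,0)$. (These conditions determine the sequence uniquely.) -}

module Defs where

open import Data.Nat using (ℕ; zero; suc; _+_; _*_; _∸_; _≤_; _<_)
open import Data.Nat.DivMod using (_/_; _%_)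
open import Data.Integer using (ℤ; +_) renaming (_+_ to _+ℤ_; _-_ to _-ℤ_; _*_ to _*ℤ_)
open import Data.Sum using (_⊎_)
open import Data.Product using (_×_)
open import Relation.Binary.PropositionalEquality using (_≡_)

-- A sequence of matrices (M_n)_{n ≥ 1} is encoded as  F : ℕ → ℕ → ℕ → ℕ
-- with  F n m k = f_n(m,k)  (1-based indices m,k; the value at n = 0 is unused).

Σ₁ : ℕ → (ℕ → ℕ) → ℕ
Σ₁ zero    g = 0
Σ₁ (suc N) g = Σ₁ N g + g (suc N)

rowSum : (ℕ → ℕ → ℕ → ℕ) → ℕ → ℕ → ℕ
rowSum F n m = Σ₁ (2 * n) (λ k → F n m k)

colSum : (ℕ → ℕ → ℕ → ℕ) → ℕ → ℕ → ℕ
colSum F n k = Σ₁ (2 * n) (λ m → F n m k)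

record IsDeltaSequence (F : ℕ → ℕ → ℕ → ℕ) : Set where
  field
    outside : ∀ n m k → 1 ≤ n →
              (m ≡ 0 ⊎ 2 * n < m ⊎ k ≡ 0 ⊎ 2 * n < k) → F n m k ≡ 0
    M₁-11 : F 1 1 1 ≡ 0
    M₁-12 : F 1 1 2 ≡ 0
    M₁-21 : F 1 2 1 ≡ 1
    M₁-22 : F 1 2 2 ≡ 0
    diag : ∀ n m → 2 ≤ n → F n m m ≡ 0
    recL : ∀ n m k → 2 ≤ n → 2 ≤ k + 1 → k + 1 ≤ m → m ≤ 2 * n ∸ 2 →
           (+ F n (m + 2) k) -ℤ (+ 2) *ℤ (+ F n (m + 1) k) +ℤ (+ F n m k)
             +ℤ (+ 2) *ℤ (+ F (n ∸ 1) m k) ≡ + 0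
    recU : ∀ n m k → 2 ≤ n → 2 ≤ m + 1 → m + 1 ≤ k → k ≤ 2 * n ∸ 2 →
           (+ F n m (k + 2)) -ℤ (+ 2) *ℤ (+ F n m (k + 1)) +ℤ (+ F n m k)
             +ℤ (+ 2) *ℤ (+ F (n ∸ 1) m k) ≡ + 0
    col2n     : ∀ n m → 2 ≤ n → 1 ≤ m → m ≤ 2 * n → F n m (2 * n) ≡ 0
    col2n-1   : ∀ n m → 2 ≤ n → 1 ≤ m → m ≤ 2 * n ∸ 2 →
                F n m (2 * n ∸ 1) ≡ rowSum F (n ∸ 1) m
    col2n-1-a : ∀ n → 2 ≤ n → F n (2 * n ∸ 1) (2 * n ∸ 1) ≡ 0
    col2n-1-b : ∀ n → 2 ≤ n → F n (2 * n) (2 * n ∸ 1) ≡ 0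
    row2n     : ∀ n k → 2 ≤ n → 1 ≤ k → k ≤ 2 * n ∸ 2 →
                F n (2 * n) k ≡ rowSum F (n ∸ 1) k
    row2n-a   : ∀ n → 2 ≤ n → F n (2 * n) (2 * n ∸ 1) ≡ 0
    row2n-b   : ∀ n → 2 ≤ n → F n (2 * n) (2 * n) ≡ 0
    row2n-1   : ∀ n k → 2 ≤ n → 1 ≤ k → k ≤ 2 * n ∸ 2 →
                F n (2 * n ∸ 1) k ≡ rowSum F (n ∸ 1) k + colSum F (n ∸ 1) k
    row2n-1-a : ∀ n → 2 ≤ n → F n (2 * n ∸ 1) (2 * n ∸ 1) ≡ 0
    row2n-1-b : ∀ n → 2 ≤ n → F n (2 * n ∸ 1) (2 * n) ≡ 0

Λ : (ℕ → ℕ → ℕ → ℕ) → ℕ → ℕ → ℕ → ℕ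
Λ F p i j with (p + i + j) % 2
... | zero  = 0
... | suc _ = F ((p + i + j + 1) / 2) (i + j + 2) (j + 1)

IsPoupard : (ℕ → ℕ → ℕ) → Set
IsPoupard λ' = ∀ i j →
  (+ λ' i (j + 2)) -ℤ (+ 2) *ℤ (+ λ' (i + 1) (j + 1)) +ℤ (+ λ' (i + 2) j)
    +ℤ (+ 2) *ℤ (+ λ' i j) ≡ + 0

-- For even p + i + j the four entries of the relation at (i, j) vanish; for odd p + i + j =
-- 2q + 1 the relation is the "lower relation" of M_{n+1}, n = q + 1, along row M + 2 = i + j + 4
-- at column k = j + 1:  f_{n+1}(M+2,k+2) − 2f_{n+1}(M+2,k+1) + f_{n+1}(M+2,k) + 2f_n(M,k) = 0.
-- The lower relations (and their transposes, the upper relations) are proved by induction on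
-- n together with boundary facts about M_n: the recurrence of the row sums R_n, the vanishing
-- first row, row 2 and columns 1, 2 of M_{n+1} as reversed row sums of M_n, and the duality
-- R_n(m) = C_n(2n+1−m).  For fixed n the lower relations are obtained downwards in M: on the
-- last two rows they are the recurrences of R_n and of R_n + C_n, and above those they
-- descend because horizontal and vertical second differences commute.  The boundary facts for
-- M_{n+1} come from splitting its lines at the diagonal 3 × 3 block, whose corners balance by
-- a telescoping argument.
module Submission where

open import Data.Nat using (ℕ; zero; suc; _+_; _*_; _∸_; _<_; _≤_; z≤n; s≤s; _≤?_)
open import Data.Nat.Properties
  using ( +-identityʳ; +-suc; +-assoc; +-comm; +-cancelˡ-≡; +-monoʳ-≤; +-monoˡ-≤; +-commutativeSemigroup
        ; ≤-refl; ≤-reflexive; ≤-trans; ≤-antisym; ≤-pred; <-cmp; <⇒≱; ≰⇒>; m<n⇒m<1+n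
        ; m≤m+n; m≤n+m; n≤1+n; m≤n⇒∃[o]m+o≡n )
open import Data.Nat.DivMod using (_%_; _/_; m*n%n≡0; [m+kn]%n≡m%n; m*n/n≡m)
import Data.Nat.Tactic.RingSolver as ℕ-Solver
open import Algebra.Properties.CommutativeSemigroup +-commutativeSemigroup using (interchange; x∙yz≈y∙xz)
open import Data.Integer using (ℤ; +_; 0ℤ) renaming (_+_ to _+ℤ_; _-_ to _-ℤ_; _*_ to _*ℤ_)
import Data.Integer.Properties as ℤP
open import Data.Integer.Tactic.RingSolver using (solve-∀)
open import Data.Empty using (⊥; ⊥-elim)
open import Data.Unit using (⊤; tt)
open import Data.Product using (_×_; _,_; proj₁; proj₂; ∃)
open import Data.Sum using (_⊎_; inj₁; inj₂)
open import Relation.Nullary using (yes; no)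
open import Relation.Binary.Definitions using (tri<; tri≈; tri>)
open import Relation.Binary.PropositionalEquality

open import Defs

two-step : (P : ℕ → Set) → P 0 → P 1 → (∀ t → P t → P (suc t) → P (2 + t)) → ∀ t → P t
two-step P p₀ p₁ step t = proj₁ (pair t)
  where
    pair : ∀ t → P t × P (suc t)
    pair zero    = p₀ , p₁
    pair (suc t) = proj₂ (pair t) , step t (proj₁ (pair t)) (proj₂ (pair t))

downward : (Q : ℕ → Set) (T : ℕ) → Q T → (∀ M → suc M ≡ T → Q M) →
           (∀ M → 2 + M ≤ T → Q (1 + M) → Q (2 + M) → Q M) → ∀ M → M ≤ T → Q M
downward Q T q₀ q₁ step M M≤T with m≤n⇒∃[o]m+o≡n M≤T
... | t , M+t≡T = two-step P at-T at-T-1 down t M M+t≡T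
  where
    P : ℕ → Set
    P t = ∀ M → M + t ≡ T → Q M
    at-T : P 0
    at-T M e = subst Q (sym (trans (sym (+-identityʳ M)) e)) q₀
    at-T-1 : P 1
    at-T-1 M e = q₁ M (trans (+-comm 1 M) e)
    down : ∀ t → P t → P (suc t) → P (2 + t)
    down t p₀ p₁ M e = step M (subst (2 + M ≤_) e′ (m≤m+n (2 + M) t))
                         (p₁ (1 + M) (trans (sym (+-suc M (suc t))) e)) (p₀ (2 + M) e′)
      where
        e′ : 2 + M + t ≡ T
        e′ = trans (cong suc (sym (+-suc M t))) (trans (sym (+-suc M (suc t))) e)

shift-sum : ∀ a b k t D → k + t ≡ D → (a + k) + (b + t) ≡ (a + b) + D
shift-sum a b k t D e = trans (interchange a k b t) (cong (λ x → (a + b) + x) e)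

drop-sum : ∀ a k t D → k + (a + t) ≡ a + D → k + t ≡ D
drop-sum a k t D e = +-cancelˡ-≡ a (k + t) D (trans (x∙yz≈y∙xz a k t) e)

mirror-index : ∀ c t s L → t + s + 1 ≡ L → (c + t) + suc s ≡ c + L
mirror-index c t s L e = trans (+-assoc c t (suc s)) (cong (λ x → c + x) (trans (+-suc t s) (trans (+-comm 1 (t + s)) e)))

position : ∀ k j D → k + j ≡ j + D → k ≡ D
position k j D e = +-cancelˡ-≡ j k D (trans (+-comm j k) e)

beyond-length : ∀ {k t D} → D < k → k + t ≡ D → ⊥
beyond-length {k} {t} D<k e = <⇒≱ D<k (subst (k ≤_) e (m≤m+n k t))

twice : ℕ → ℕ
twice n = n + n

2*≡twice : ∀ n → 2 * n ≡ twice n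
2*≡twice n = cong (λ x → n + x) (+-identityʳ n)

twice-suc : ∀ n → twice (suc n) ≡ 2 + twice n
twice-suc n = cong suc (+-suc n n)

size : ∀ n → 2 * suc n ≡ 2 + twice n
size n = trans (2*≡twice (suc n)) (twice-suc n)

size∸1 : ∀ n → 2 * suc n ∸ 1 ≡ 1 + twice n
size∸1 n = cong (_∸ 1) (size n)

size∸2 : ∀ n → 2 * suc n ∸ 2 ≡ twice n
size∸2 n = cong (_∸ 2) (size n)

Σℤ : ℕ → (ℕ → ℤ) → ℤ
Σℤ zero    h = 0ℤ
Σℤ (suc L) h = Σℤ L h +ℤ h L

Σℤ-cong : ∀ L {h h′ : ℕ → ℤ} → (∀ t → t < L → h t ≡ h′ t) → Σℤ L h ≡ Σℤ L h′
Σℤ-cong zero    eq = refl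
Σℤ-cong (suc L) eq = cong₂ _+ℤ_ (Σℤ-cong L (λ t t<L → eq t (m<n⇒m<1+n t<L))) (eq L ≤-refl)

Σℤ-zero : ∀ L {h : ℕ → ℤ} → (∀ t → t < L → h t ≡ 0ℤ) → Σℤ L h ≡ 0ℤ
Σℤ-zero zero    eq = refl
Σℤ-zero (suc L) eq = cong₂ _+ℤ_ (Σℤ-zero L (λ t t<L → eq t (m<n⇒m<1+n t<L))) (eq L ≤-refl)

Σℤ-+ : ∀ L (h h′ : ℕ → ℤ) → Σℤ L (λ t → h t +ℤ h′ t) ≡ Σℤ L h +ℤ Σℤ L h′
Σℤ-+ zero    h h′ = refl
Σℤ-+ (suc L) h h′ = trans (cong (_+ℤ (h L +ℤ h′ L)) (Σℤ-+ L h h′)) (swap (Σℤ L h) (Σℤ L h′) (h L) (h′ L))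
  where
    swap : ∀ a b c e → (a +ℤ b) +ℤ (c +ℤ e) ≡ (a +ℤ c) +ℤ (b +ℤ e)
    swap = solve-∀

Σℤ-peel : ∀ L (h : ℕ → ℤ) → Σℤ (suc L) h ≡ h 0 +ℤ Σℤ L (λ t → h (suc t))
Σℤ-peel zero    h = trans (ℤP.+-identityˡ (h 0)) (sym (ℤP.+-identityʳ (h 0)))
Σℤ-peel (suc L) h = trans (cong (_+ℤ h (suc L)) (Σℤ-peel L h)) (ℤP.+-assoc (h 0) _ (h (suc L)))

Σℤ-split : ∀ a b (h : ℕ → ℤ) → Σℤ (a + b) h ≡ Σℤ a h +ℤ Σℤ b (λ t → h (a + t))
Σℤ-split a zero    h = trans (cong (λ L → Σℤ L h) (+-identityʳ a)) (sym (ℤP.+-identityʳ (Σℤ a h)))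
Σℤ-split a (suc b) h = begin
  Σℤ (a + suc b) h                                     ≡⟨ cong (λ L → Σℤ L h) (+-suc a b) ⟩
  Σℤ (a + b) h +ℤ h (a + b)                            ≡⟨ cong (_+ℤ h (a + b)) (Σℤ-split a b h) ⟩
  Σℤ a h +ℤ Σℤ b (λ t → h (a + t)) +ℤ h (a + b)        ≡⟨ ℤP.+-assoc (Σℤ a h) _ (h (a + b)) ⟩
  Σℤ a h +ℤ Σℤ (suc b) (λ t → h (a + t))               ∎
  where open ≡-Reasoning

Σℤ-around : ∀ a b (h : ℕ → ℤ) → Σℤ (a + suc b) h ≡ Σℤ a h +ℤ h a +ℤ Σℤ b (λ t → h (suc a + t))
Σℤ-around a b h = begin
  Σℤ (a + suc b) h                                        ≡⟨ Σℤ-split a (suc b) h ⟩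
  Σℤ a h +ℤ Σℤ (suc b) (λ t → h (a + t))                  ≡⟨ cong (Σℤ a h +ℤ_) (Σℤ-peel b (λ t → h (a + t))) ⟩
  Σℤ a h +ℤ (h (a + 0) +ℤ Σℤ b (λ t → h (a + suc t)))     ≡⟨ cong (Σℤ a h +ℤ_) (cong₂ _+ℤ_ (cong h (+-identityʳ a))
                                                                (Σℤ-cong b (λ t _ → cong h (+-suc a t)))) ⟩
  Σℤ a h +ℤ (h a +ℤ Σℤ b (λ t → h (suc a + t)))          ≡⟨ sym (ℤP.+-assoc (Σℤ a h) (h a) _) ⟩
  Σℤ a h +ℤ h a +ℤ Σℤ b (λ t → h (suc a + t))            ∎
  where open ≡-Reasoning

Σℤ-block : ∀ a b (h : ℕ → ℤ) →
           Σℤ (2 + a + suc b) h ≡ Σℤ a h +ℤ (h a +ℤ h (1 + a) +ℤ h (2 + a)) +ℤ Σℤ b (λ t → h (3 + a + t))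
Σℤ-block a b h = trans (Σℤ-around (2 + a) b h) (regroup (Σℤ a h) (h a) (h (1 + a)) (h (2 + a)) _)
  where
    regroup : ∀ s x y z r → s +ℤ x +ℤ y +ℤ z +ℤ r ≡ s +ℤ (x +ℤ y +ℤ z) +ℤ r
    regroup = solve-∀

Σℤ-pad : ∀ L (h : ℕ → ℤ) → h L ≡ 0ℤ → h (1 + L) ≡ 0ℤ → Σℤ (2 + L) h ≡ Σℤ L h
Σℤ-pad L h z₀ z₁ = trans (cong₂ (λ x y → Σℤ L h +ℤ x +ℤ y) z₀ z₁)
                         (trans (ℤP.+-identityʳ (Σℤ L h +ℤ 0ℤ)) (ℤP.+-identityʳ (Σℤ L h)))

Σℤ-reverse : ∀ L (h h′ : ℕ → ℤ) → (∀ t s → t + s + 1 ≡ L → h t ≡ h′ s) → Σℤ L h ≡ Σℤ L h′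
Σℤ-reverse zero    h h′ eq = refl
Σℤ-reverse (suc L) h h′ eq = begin
  Σℤ L h +ℤ h L                          ≡⟨ cong₂ _+ℤ_ (Σℤ-reverse L h (λ t → h′ (suc t)) shifted) last ⟩
  Σℤ L (λ t → h′ (suc t)) +ℤ h′ 0        ≡⟨ ℤP.+-comm _ (h′ 0) ⟩
  h′ 0 +ℤ Σℤ L (λ t → h′ (suc t))        ≡⟨ sym (Σℤ-peel L h′) ⟩
  Σℤ (suc L) h′                          ∎
  where
    open ≡-Reasoning
    shifted : ∀ t s → t + s + 1 ≡ L → h t ≡ h′ (suc s)
    shifted t s e = eq t (suc s) (trans (cong (_+ 1) (+-suc t s)) (cong suc e))
    last : h L ≡ h′ 0
    last = eq L 0 (trans (cong (_+ 1) (+-identityʳ L)) (+-comm L 1))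

Σ₁-as-Σℤ : ∀ L (h : ℕ → ℕ) → + Σ₁ L h ≡ Σℤ L (λ t → + h (suc t))
Σ₁-as-Σℤ zero    h = refl
Σ₁-as-Σℤ (suc L) h = cong (_+ℤ + h (suc L)) (Σ₁-as-Σℤ L h)

-- The Poupard form a − 2b + c + 2e, kept opaque so that the relations below are
-- manipulated through the lemmas that follow.
opaque
  poupard : ℤ → ℤ → ℤ → ℤ → ℤ
  poupard a b c e = a -ℤ + 2 *ℤ b +ℤ c +ℤ + 2 *ℤ e

Poupard : ℤ → ℤ → ℤ → ℤ → Set
Poupard a b c e = poupard a b c e ≡ 0ℤ

poupard-cong : ∀ {a b c e a′ b′ c′ e′} → a ≡ a′ → b ≡ b′ → c ≡ c′ → e ≡ e′ →
               Poupard a′ b′ c′ e′ → Poupard a b c e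
poupard-cong refl refl refl refl p = p

opaque
  unfolding poupard

  poupard-expand : ∀ {a b c e} → a -ℤ + 2 *ℤ b +ℤ c +ℤ + 2 *ℤ e ≡ 0ℤ → Poupard a b c e
  poupard-expand p = p

  poupard-unexpand : ∀ {a b c e} → Poupard a b c e → a -ℤ + 2 *ℤ b +ℤ c +ℤ + 2 *ℤ e ≡ 0ℤ
  poupard-unexpand p = p

  poupard-zeros : ∀ {a b c e} → a ≡ 0ℤ → b ≡ 0ℤ → c ≡ 0ℤ → e ≡ 0ℤ → Poupard a b c e
  poupard-zeros refl refl refl refl = refl

  poupard-add : ∀ {a b c e x y z w} → Poupard a b c e → Poupard x y z w →
                Poupard (a +ℤ x) (b +ℤ y) (c +ℤ z) (e +ℤ w)
  poupard-add {a} {b} {c} {e} {x} {y} {z} {w} p q = begin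
    poupard (a +ℤ x) (b +ℤ y) (c +ℤ z) (e +ℤ w) ≡⟨ split a b c e x y z w ⟩
    poupard a b c e +ℤ poupard x y z w          ≡⟨ cong₂ _+ℤ_ p q ⟩
    0ℤ                                          ∎
    where
      open ≡-Reasoning
      split : ∀ a b c e x y z w →
              (a +ℤ x) -ℤ + 2 *ℤ (b +ℤ y) +ℤ (c +ℤ z) +ℤ + 2 *ℤ (e +ℤ w)
                ≡ (a -ℤ + 2 *ℤ b +ℤ c +ℤ + 2 *ℤ e) +ℤ (x -ℤ + 2 *ℤ y +ℤ z +ℤ + 2 *ℤ w)
      split = solve-∀

  poupard-unique : ∀ {a b c e c′} → Poupard a b c e → Poupard c′ b a e → c ≡ c′
  poupard-unique {a} {b} {c} {e} {c′} p q = begin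
    c                                                  ≡⟨ difference a b c e c′ ⟩
    c′ +ℤ (poupard a b c e -ℤ poupard c′ b a e)        ≡⟨ cong (λ x → c′ +ℤ x) (cong₂ _-ℤ_ p q) ⟩
    c′ +ℤ 0ℤ                                           ≡⟨ ℤP.+-identityʳ c′ ⟩
    c′                                                 ∎
    where
      open ≡-Reasoning
      difference : ∀ a b c e c′ →
                   c ≡ c′ +ℤ ((a -ℤ + 2 *ℤ b +ℤ c +ℤ + 2 *ℤ e) -ℤ (c′ -ℤ + 2 *ℤ b +ℤ a +ℤ + 2 *ℤ e))
      difference = solve-∀

  -- Summing the relations between consecutive entries h t, h (t+1), h (t+2) of one line
  -- telescopes: the second differences sum to a difference of first differences.
  poupard-telescope : ∀ L (h w : ℕ → ℤ) → (∀ t → t < L → Poupard (h (2 + t)) (h (1 + t)) (h t) (w t)) →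
                      h (1 + L) -ℤ h L -ℤ h 1 +ℤ h 0 +ℤ + 2 *ℤ Σℤ L w ≡ 0ℤ
  poupard-telescope zero    h w p = empty (h 1) (h 0)
    where
      empty : ∀ x y → x -ℤ y -ℤ x +ℤ y +ℤ + 2 *ℤ 0ℤ ≡ 0ℤ
      empty = solve-∀
  poupard-telescope (suc L) h w p = begin
    h (2 + L) -ℤ h (1 + L) -ℤ h 1 +ℤ h 0 +ℤ + 2 *ℤ (Σℤ L w +ℤ w L)
      ≡⟨ extend (h (2 + L)) (h (1 + L)) (h L) (h 1) (h 0) (Σℤ L w) (w L) ⟩
    (h (1 + L) -ℤ h L -ℤ h 1 +ℤ h 0 +ℤ + 2 *ℤ Σℤ L w) +ℤ poupard (h (2 + L)) (h (1 + L)) (h L) (w L)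
      ≡⟨ cong₂ _+ℤ_ (poupard-telescope L h w (λ t t<L → p t (m<n⇒m<1+n t<L))) (p L ≤-refl) ⟩
    0ℤ ∎
    where
      open ≡-Reasoning
      extend : ∀ a b c x y s v →
               a -ℤ b -ℤ x +ℤ y +ℤ + 2 *ℤ (s +ℤ v)
                 ≡ (b -ℤ c -ℤ x +ℤ y +ℤ + 2 *ℤ s) +ℤ (a -ℤ + 2 *ℤ b +ℤ c +ℤ + 2 *ℤ v)
      extend = solve-∀

poupard-add₃ : ∀ {a b c e x y z w p q r v} → Poupard a b c e → Poupard x y z w → Poupard p q r v →
               Poupard (a +ℤ x +ℤ p) (b +ℤ y +ℤ q) (c +ℤ z +ℤ r) (e +ℤ w +ℤ v)
poupard-add₃ {a} {b} {c} {e} {x} {y} {z} {w} P Q R =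
  poupard-add {a +ℤ x} {b +ℤ y} {c +ℤ z} {e +ℤ w} (poupard-add P Q) R

-- Two sequences satisfying the relation with the same weight, one of them read backwards,
-- agree at the third position once they agree at the first two.
poupard-mirror : ∀ {x₀ x₁ x₂ y₀ y₁ y₂ w} → Poupard x₂ x₁ x₀ w → Poupard y₂ y₁ y₀ w →
                 x₂ ≡ y₀ → x₁ ≡ y₁ → x₀ ≡ y₂
poupard-mirror p q refl refl = poupard-unique p q

poupard-Σ : ∀ L (x y z w : ℕ → ℤ) → (∀ t → t < L → Poupard (x t) (y t) (z t) (w t)) →
            Poupard (Σℤ L x) (Σℤ L y) (Σℤ L z) (Σℤ L w)
poupard-Σ zero    x y z w p = poupard-zeros refl refl refl refl
poupard-Σ (suc L) x y z w p =
  poupard-add {Σℤ L x} {Σℤ L y} {Σℤ L z} {Σℤ L w}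
              (poupard-Σ L x y z w (λ t t<L → p t (m<n⇒m<1+n t<L))) (p L ≤-refl)

tail-telescope : ∀ k u (g w : ℕ → ℤ) →
                 (∀ t → t < u → Poupard (g (2 + (suc k + t))) (g (1 + (suc k + t))) (g (suc k + t)) (w t)) →
                 g (2 + k + u) -ℤ g (1 + k + u) -ℤ g (2 + k) +ℤ g (1 + k) +ℤ + 2 *ℤ Σℤ u w ≡ 0ℤ
tail-telescope k u g w p =
  subst (λ x → x -ℤ g (1 + k + u) -ℤ g (2 + k) +ℤ g (1 + k) +ℤ + 2 *ℤ Σℤ u w ≡ 0ℤ)
        (cong g (+-suc (suc k) u))
    (subst₂ (λ x y → g (suc k + suc u) -ℤ g (suc k + u) -ℤ g x +ℤ g y +ℤ + 2 *ℤ Σℤ u w ≡ 0ℤ)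
            (+-comm (suc k) 1) (+-identityʳ (suc k))
      (poupard-telescope u (λ t → g (suc k + t)) w
         (λ t t<u → poupard-cong (cong g (cong suc (trans (+-suc k (suc t)) (cong suc (+-suc k t)))))
                                 (cong g (cong suc (+-suc k t))) refl refl (p t t<u))))

opaque
  unfolding poupard

  poupard-top : ∀ s → Poupard 0ℤ s (s +ℤ s) 0ℤ
  poupard-top = top
    where
      top : ∀ s → 0ℤ -ℤ + 2 *ℤ s +ℤ (s +ℤ s) +ℤ + 2 *ℤ 0ℤ ≡ 0ℤ
      top = solve-∀

-- A 3 × 3 block (d diagonal, l below, u above) with vanishing diagonal whose corner sum
-- l₂₀ + u₀₂ equals both l₂₁ + u₀₁ and l₁₀ + u₁₂: its row sums satisfy the Poupard relation
-- with weight 0.  (The transposed block satisfies the same hypotheses, so the same holds for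
-- its column sums.)
opaque
  unfolding poupard

  private
    balanced : ∀ {s a b : ℤ} → s ≡ a → s ≡ b → s +ℤ a -ℤ + 2 *ℤ b ≡ 0ℤ
    balanced {s} refl refl = cancel s
      where
        cancel : ∀ s → s +ℤ s -ℤ + 2 *ℤ s ≡ 0ℤ
        cancel = solve-∀

  block-rows : ∀ {d₀ d₁ d₂} l₁₀ l₂₀ l₂₁ u₀₁ u₀₂ u₁₂ → d₀ ≡ 0ℤ → d₁ ≡ 0ℤ → d₂ ≡ 0ℤ →
               l₂₀ +ℤ u₀₂ ≡ l₂₁ +ℤ u₀₁ → l₂₀ +ℤ u₀₂ ≡ l₁₀ +ℤ u₁₂ →
               Poupard (l₂₀ +ℤ l₂₁ +ℤ d₂) (l₁₀ +ℤ d₁ +ℤ u₁₂) (d₀ +ℤ u₀₁ +ℤ u₀₂) 0ℤ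
  block-rows l₁₀ l₂₀ l₂₁ u₀₁ u₀₂ u₁₂ refl refl refl e₁ e₂ =
    trans (regroup l₁₀ l₂₀ l₂₁ u₀₁ u₀₂ u₁₂) (balanced e₁ e₂)
    where
      regroup : ∀ l₁₀ l₂₀ l₂₁ u₀₁ u₀₂ u₁₂ →
        (l₂₀ +ℤ l₂₁ +ℤ 0ℤ) -ℤ + 2 *ℤ (l₁₀ +ℤ 0ℤ +ℤ u₁₂) +ℤ (0ℤ +ℤ u₀₁ +ℤ u₀₂) +ℤ + 2 *ℤ 0ℤ
          ≡ (l₂₀ +ℤ u₀₂) +ℤ (l₂₁ +ℤ u₀₁) -ℤ + 2 *ℤ (l₁₀ +ℤ u₁₂)
      regroup = solve-∀

split-recurrence : ∀ a u (x₂ x₁ x₀ v w : ℕ → ℤ) →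
  (∀ t → t < a → Poupard (x₂ t) (x₁ t) (x₀ t) (v t)) →
  Poupard (x₂ a +ℤ x₂ (1 + a) +ℤ x₂ (2 + a)) (x₁ a +ℤ x₁ (1 + a) +ℤ x₁ (2 + a)) (x₀ a +ℤ x₀ (1 + a) +ℤ x₀ (2 + a)) 0ℤ →
  (∀ t → t < u → Poupard (x₂ (3 + a + t)) (x₁ (3 + a + t)) (x₀ (3 + a + t)) (w t)) →
  Poupard (Σℤ (2 + a + suc u) x₂) (Σℤ (2 + a + suc u) x₁) (Σℤ (2 + a + suc u) x₀) (Σℤ a v +ℤ 0ℤ +ℤ Σℤ u w)
split-recurrence a u x₂ x₁ x₀ v w head block tail =
  poupard-cong (Σℤ-block a u x₂) (Σℤ-block a u x₁) (Σℤ-block a u x₀) refl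
    (poupard-add₃ (poupard-Σ a x₂ x₁ x₀ v head) block
                  (poupard-Σ u (λ t → x₂ (3 + a + t)) (λ t → x₁ (3 + a + t)) (λ t → x₀ (3 + a + t)) w tail))

balance-algebra : ∀ {T d y₁ z₀ : ℤ} A B x₀ x₁ y₀ z₁ w₀ w₁ →
                  T ≡ A +ℤ d +ℤ B → d ≡ 0ℤ → y₁ ≡ y₀ +ℤ T → z₀ ≡ z₁ +ℤ T →
                  x₁ -ℤ x₀ -ℤ y₁ +ℤ y₀ +ℤ + 2 *ℤ A ≡ 0ℤ → z₁ -ℤ z₀ -ℤ w₁ +ℤ w₀ +ℤ + 2 *ℤ B ≡ 0ℤ →
                  x₀ +ℤ w₁ ≡ x₁ +ℤ w₀
balance-algebra A B x₀ x₁ y₀ z₁ w₀ w₁ refl refl refl refl tel₁ tel₂ = begin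
  x₀ +ℤ w₁
    ≡⟨ combine A B x₀ x₁ y₀ z₁ w₀ w₁ ⟩
  x₁ +ℤ w₀ -ℤ (x₁ -ℤ x₀ -ℤ (y₀ +ℤ T) +ℤ y₀ +ℤ + 2 *ℤ A) -ℤ (z₁ -ℤ (z₁ +ℤ T) -ℤ w₁ +ℤ w₀ +ℤ + 2 *ℤ B)
    ≡⟨ cong₂ (λ p q → x₁ +ℤ w₀ -ℤ p -ℤ q) tel₁ tel₂ ⟩
  x₁ +ℤ w₀ +ℤ 0ℤ +ℤ 0ℤ
    ≡⟨ trans (ℤP.+-identityʳ _) (ℤP.+-identityʳ _) ⟩
  x₁ +ℤ w₀ ∎
  where
    open ≡-Reasoning
    T : ℤ
    T = A +ℤ 0ℤ +ℤ B
    combine : ∀ A B x₀ x₁ y₀ z₁ w₀ w₁ → x₀ +ℤ w₁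
      ≡ x₁ +ℤ w₀ -ℤ (x₁ -ℤ x₀ -ℤ (y₀ +ℤ (A +ℤ 0ℤ +ℤ B)) +ℤ y₀ +ℤ + 2 *ℤ A)
                 -ℤ (z₁ -ℤ (z₁ +ℤ (A +ℤ 0ℤ +ℤ B)) -ℤ w₁ +ℤ w₀ +ℤ + 2 *ℤ B)
    combine = solve-∀

-- The second difference of the row (a₀,a₁,a₂) with weight e₀ is a combination of the second
-- differences of the rows (b), (c) and (e₂,p₁,p₂), and of the columns (a,b,c) and (e₀,e₁,e₂).
second-differences-commute : ∀ a₂ a₁ a₀ b₂ b₁ b₀ c₂ c₁ c₀ e₀ e₁ e₂ p₁ p₂ q →
    a₂ -ℤ + 2 *ℤ a₁ +ℤ a₀ +ℤ + 2 *ℤ e₀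
      ≡ + 2 *ℤ (b₂ -ℤ + 2 *ℤ b₁ +ℤ b₀ +ℤ + 2 *ℤ e₁) -ℤ (c₂ -ℤ + 2 *ℤ c₁ +ℤ c₀ +ℤ + 2 *ℤ e₂)
        -ℤ + 2 *ℤ (p₂ -ℤ + 2 *ℤ p₁ +ℤ e₂ +ℤ + 2 *ℤ q)
        +ℤ (c₂ -ℤ + 2 *ℤ b₂ +ℤ a₂ +ℤ + 2 *ℤ p₂) -ℤ + 2 *ℤ (c₁ -ℤ + 2 *ℤ b₁ +ℤ a₁ +ℤ + 2 *ℤ p₁)
        +ℤ (c₀ -ℤ + 2 *ℤ b₀ +ℤ a₀ +ℤ + 2 *ℤ e₂) +ℤ + 2 *ℤ (e₂ -ℤ + 2 *ℤ e₁ +ℤ e₀ +ℤ + 2 *ℤ q)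
second-differences-commute = solve-∀

vanishing-combination : ∀ {x h₁ h₂ h′ v₂ v₁ v₀ v′} →
  x ≡ + 2 *ℤ h₁ -ℤ h₂ -ℤ + 2 *ℤ h′ +ℤ v₂ -ℤ + 2 *ℤ v₁ +ℤ v₀ +ℤ + 2 *ℤ v′ →
  h₁ ≡ 0ℤ → h₂ ≡ 0ℤ → h′ ≡ 0ℤ → v₂ ≡ 0ℤ → v₁ ≡ 0ℤ → v₀ ≡ 0ℤ → v′ ≡ 0ℤ → x ≡ 0ℤ
vanishing-combination e refl refl refl refl refl refl refl = e

-- The Poupard relations of a family of arrays A n (levels n, rows m, columns k), linking
-- a 3-term line at level n + 1 with one entry of level n: vertically along column k from
-- row m, and horizontally along row M + 2 from column k.
module Relations (A : ℕ → ℕ → ℕ → ℤ) where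

  Vertical : ℕ → ℕ → ℕ → Set
  Vertical n m k = Poupard (A (suc n) (2 + m) k) (A (suc n) (1 + m) k) (A (suc n) m k) (A n m k)

  Horizontal : ℕ → ℕ → ℕ → Set
  Horizontal n k M = Poupard (A (suc n) (2 + M) (2 + k)) (A (suc n) (2 + M) (1 + k)) (A (suc n) (2 + M) k) (A n M k)

  -- Horizontal and vertical second differences commute, so a horizontal relation at level
  -- n + 1 follows from the two below it, the one at level n, and the vertical relations.
  horizontal-step : ∀ n k M →
    Vertical (suc n) (2 + M) (2 + k) → Vertical (suc n) (2 + M) (1 + k) → Vertical (suc n) (2 + M) k →
    Vertical n M k → Horizontal n k M →
    Horizontal (suc n) k (1 + M) → Horizontal (suc n) k (2 + M) → Horizontal (suc n) k M
  horizontal-step n k M v₂ v₁ v₀ v′ h′ h₁ h₂ =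
    poupard-expand (vanishing-combination (second-differences-commute a₂ a₁ a₀ b₂ b₁ b₀ c₂ c₁ c₀ e₀ e₁ e₂ p₁ p₂ q)
                      (poupard-unexpand h₁) (poupard-unexpand h₂) (poupard-unexpand h′)
                      (poupard-unexpand v₂) (poupard-unexpand v₁) (poupard-unexpand v₀) (poupard-unexpand v′))
    where
      a₂ a₁ a₀ b₂ b₁ b₀ c₂ c₁ c₀ e₀ e₁ e₂ p₁ p₂ q : ℤ
      a₂ = A (2 + n) (2 + M) (2 + k) ; a₁ = A (2 + n) (2 + M) (1 + k) ; a₀ = A (2 + n) (2 + M) k
      b₂ = A (2 + n) (3 + M) (2 + k) ; b₁ = A (2 + n) (3 + M) (1 + k) ; b₀ = A (2 + n) (3 + M) k
      c₂ = A (2 + n) (4 + M) (2 + k) ; c₁ = A (2 + n) (4 + M) (1 + k) ; c₀ = A (2 + n) (4 + M) k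
      e₀ = A (suc n) M k ; e₁ = A (suc n) (1 + M) k ; e₂ = A (suc n) (2 + M) k
      p₁ = A (suc n) (2 + M) (1 + k) ; p₂ = A (suc n) (2 + M) (2 + k) ; q = A n M k

module Delta (F : ℕ → ℕ → ℕ → ℕ) (isΔ : IsDeltaSequence F) where
  open IsDeltaSequence isΔ

  -- Entries f_n(m,k), row sums f_n(m,•), column sums f_n(•,k) and their totals, as integers;
  -- opaque, so that they are handled as atoms.
  opaque
    f : ℕ → ℕ → ℕ → ℤ
    f n m k = + F n m k

    R : ℕ → ℕ → ℤ
    R n m = + rowSum F n m

    C : ℕ → ℕ → ℤ
    C n k = + colSum F n k

  S : ℕ → ℕ → ℤ
  S n k = R n k +ℤ C n k

  opaque
    unfolding f R C

    f-entry : ∀ {n m k x} → F n m k ≡ x → f n m k ≡ + x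
    f-entry = cong (λ x → + x)

    f-row-sum : ∀ {n m k n′ m′} → F n m k ≡ rowSum F n′ m′ → f n m k ≡ R n′ m′
    f-row-sum = cong (λ x → + x)

    f-total : ∀ {n m k n′ k′} → F n m k ≡ rowSum F n′ k′ + colSum F n′ k′ → f n m k ≡ S n′ k′
    f-total = cong (λ x → + x)

    f-of-F : ∀ n m k → + F n m k ≡ f n m k
    f-of-F n m k = refl

    R-sum : ∀ n m → R n m ≡ Σℤ (twice n) (λ t → f n m (suc t))
    R-sum n m = trans (cong (λ L → + Σ₁ L (F n m)) (2*≡twice n)) (Σ₁-as-Σℤ (twice n) (F n m))

    C-sum : ∀ n k → C n k ≡ Σℤ (twice n) (λ t → f n (suc t) k)
    C-sum n k = trans (cong (λ L → + Σ₁ L (λ m → F n m k)) (2*≡twice n)) (Σ₁-as-Σℤ (twice n) (λ m → F n m k))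

    lower-recurrence : ∀ n m k → 1 ≤ n → 1 ≤ k → k < m → m ≤ twice n →
                       Poupard (f (suc n) (2 + m) k) (f (suc n) (1 + m) k) (f (suc n) m k) (f n m k)
    lower-recurrence n m k p q r s =
      subst₂ (λ a b → Poupard (f (suc n) a k) (f (suc n) b k) (f (suc n) m k) (f n m k)) (+-comm m 2) (+-comm m 1)
        (poupard-expand (recL (suc n) m k (s≤s p) (subst (2 ≤_) (+-comm 1 k) (s≤s q)) (subst (_≤ m) (+-comm 1 k) r)
              (subst (m ≤_) (sym (size∸2 n)) s)))

    upper-recurrence : ∀ n m k → 1 ≤ n → 1 ≤ m → m < k → k ≤ twice n →
                       Poupard (f (suc n) m (2 + k)) (f (suc n) m (1 + k)) (f (suc n) m k) (f n m k)
    upper-recurrence n m k p q r s =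
      subst₂ (λ a b → Poupard (f (suc n) m a) (f (suc n) m b) (f (suc n) m k) (f n m k)) (+-comm k 2) (+-comm k 1)
        (poupard-expand (recU (suc n) m k (s≤s p) (subst (2 ≤_) (+-comm 1 m) (s≤s q)) (subst (_≤ k) (+-comm 1 m) r)
              (subst (k ≤_) (sym (size∸2 n)) s)))

  beyond-row : ∀ n m k → 1 ≤ n → twice n < m → f n m k ≡ 0ℤ
  beyond-row n m k p q = f-entry (outside n m k p (inj₂ (inj₁ (subst (_< m) (sym (2*≡twice n)) q))))

  beyond-col : ∀ n m k → 1 ≤ n → twice n < k → f n m k ≡ 0ℤ
  beyond-col n m k p q = f-entry (outside n m k p (inj₂ (inj₂ (inj₂ (subst (_< k) (sym (2*≡twice n)) q)))))

  row-zero : ∀ n k → 1 ≤ n → f n 0 k ≡ 0ℤ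
  row-zero n k p = f-entry (outside n 0 k p (inj₁ refl))

  col-zero : ∀ n m → 1 ≤ n → f n m 0 ≡ 0ℤ
  col-zero n m p = f-entry (outside n m 0 p (inj₂ (inj₂ (inj₁ refl))))

  R-beyond : ∀ n m → 1 ≤ n → twice n < m → R n m ≡ 0ℤ
  R-beyond n m p q = trans (R-sum n m) (Σℤ-zero (twice n) (λ t _ → beyond-row n m (suc t) p q))

  C-beyond : ∀ n k → 1 ≤ n → twice n < k → C n k ≡ 0ℤ
  C-beyond n k p q = trans (C-sum n k) (Σℤ-zero (twice n) (λ t _ → beyond-col n (suc t) k p q))

  R-zero : ∀ n → 1 ≤ n → R n 0 ≡ 0ℤ
  R-zero n p = trans (R-sum n 0) (Σℤ-zero (twice n) (λ t _ → row-zero n (suc t) p))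

  C-zero : ∀ n → 1 ≤ n → C n 0 ≡ 0ℤ
  C-zero n p = trans (C-sum n 0) (Σℤ-zero (twice n) (λ t _ → col-zero n (suc t) p))

  diagonal : ∀ n m → 1 ≤ n → f n m m ≡ 0ℤ
  diagonal (suc (suc n)) m _ = f-entry (diag (suc (suc n)) m (s≤s (s≤s z≤n)))
  diagonal (suc zero) zero _ = row-zero 1 0 (s≤s z≤n)
  diagonal (suc zero) (suc zero) _ = f-entry M₁-11
  diagonal (suc zero) (suc (suc zero)) _ = f-entry M₁-22
  diagonal (suc zero) (suc (suc (suc m))) p = beyond-row 1 _ _ p (s≤s (s≤s (s≤s z≤n)))

  last-column : ∀ n m → 1 ≤ n → f (suc n) m (2 + twice n) ≡ 0ℤ
  last-column n zero    p = row-zero (suc n) _ (s≤s z≤n)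
  last-column n (suc m) p with suc m ≤? 2 + twice n
  ... | yes q = f-entry (subst (λ x → F (suc n) (suc m) x ≡ 0) (size n)
                          (col2n (suc n) (suc m) (s≤s p) (s≤s z≤n) (subst (suc m ≤_) (sym (size n)) q)))
  ... | no q  = beyond-row (suc n) (suc m) _ (s≤s z≤n) (subst (_< suc m) (sym (twice-suc n)) (≰⇒> q))

  -- A line v of M_{n+1} prescribed by (d)/(e): it agrees with w at the positions 1,…,2n and
  -- vanishes at 2n+1, 2n+2 and beyond.  Since w vanishes beyond 2n, v = w from position 1 on.
  boundary-line : ∀ n (v w : ℕ → ℤ) →
                  (∀ k → 1 ≤ k → k ≤ twice n → v k ≡ w k) →
                  v (1 + twice n) ≡ 0ℤ → v (2 + twice n) ≡ 0ℤ → (∀ k → 2 + twice n < k → v k ≡ 0ℤ) →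
                  (∀ k → twice n < k → w k ≡ 0ℤ) →
                  ∀ k → 1 ≤ k → v k ≡ w k
  boundary-line n v w inside v₁ v₂ v-beyond w-beyond k 1≤k with k ≤? twice n
  ... | yes k≤2n = inside k 1≤k k≤2n
  ... | no k≰2n with <-cmp k (2 + twice n)
  ...   | tri> _ _ k>    = trans (v-beyond k k>) (sym (w-beyond k (≰⇒> k≰2n)))
  ...   | tri≈ _ refl _  = trans v₂ (sym (w-beyond k (≰⇒> k≰2n)))
  ...   | tri< k< _ _ with ≤-antisym (≤-pred k<) (≰⇒> k≰2n)
  ...     | refl = trans v₁ (sym (w-beyond k (≰⇒> k≰2n)))

  column-before-last : ∀ n m → 1 ≤ n → 1 ≤ m → f (suc n) m (1 + twice n) ≡ R n m
  column-before-last n m p = boundary-line n (λ m → f (suc n) m (1 + twice n)) (R n)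
    (λ m q r → f-row-sum (subst (λ x → F (suc n) m x ≡ rowSum F n m) (size∸1 n)
                 (col2n-1 (suc n) m (s≤s p) q (subst (m ≤_) (sym (size∸2 n)) r))))
    (f-entry (subst (λ x → F (suc n) x x ≡ 0) (size∸1 n) (col2n-1-a (suc n) (s≤s p))))
    (f-entry (subst₂ (λ x y → F (suc n) x y ≡ 0) (size n) (size∸1 n) (col2n-1-b (suc n) (s≤s p))))
    (λ m q → beyond-row (suc n) m _ (s≤s z≤n) (subst (_< m) (sym (twice-suc n)) q))
    (λ m q → R-beyond n m p q) m

  last-row : ∀ n k → 1 ≤ n → 1 ≤ k → f (suc n) (2 + twice n) k ≡ R n k
  last-row n k p = boundary-line n (f (suc n) (2 + twice n)) (R n)
    (λ k q r → f-row-sum (subst (λ x → F (suc n) x k ≡ rowSum F n k) (size n)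
                 (row2n (suc n) k (s≤s p) q (subst (k ≤_) (sym (size∸2 n)) r))))
    (f-entry (subst₂ (λ x y → F (suc n) x y ≡ 0) (size n) (size∸1 n) (row2n-a (suc n) (s≤s p))))
    (f-entry (subst (λ x → F (suc n) x x ≡ 0) (size n) (row2n-b (suc n) (s≤s p))))
    (λ k q → beyond-col (suc n) _ k (s≤s z≤n) (subst (_< k) (sym (twice-suc n)) q))
    (λ k q → R-beyond n k p q) k

  row-before-last : ∀ n k → 1 ≤ n → 1 ≤ k → f (suc n) (1 + twice n) k ≡ S n k
  row-before-last n k p = boundary-line n (f (suc n) (1 + twice n)) (S n)
    (λ k q r → f-total (subst (λ x → F (suc n) x k ≡ rowSum F n k + colSum F n k) (size∸1 n)
                 (row2n-1 (suc n) k (s≤s p) q (subst (k ≤_) (sym (size∸2 n)) r))))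
    (f-entry (subst (λ x → F (suc n) x x ≡ 0) (size∸1 n) (row2n-1-a (suc n) (s≤s p))))
    (f-entry (subst₂ (λ x y → F (suc n) x y ≡ 0) (size∸1 n) (size n) (row2n-1-b (suc n) (s≤s p))))
    (λ k q → beyond-col (suc n) _ k (s≤s z≤n) (subst (_< k) (sym (twice-suc n)) q))
    (λ k q → cong₂ _+ℤ_ (R-beyond n k p q) (C-beyond n k p q)) k

  beyond-row-next : ∀ n m k → 2 + twice n < m → f (suc n) m k ≡ 0ℤ
  beyond-row-next n m k q = beyond-row (suc n) m k (s≤s z≤n) (subst (_< m) (sym (twice-suc n)) q)

  beyond-col-next : ∀ n m k → 2 + twice n < k → f (suc n) m k ≡ 0ℤ
  beyond-col-next n m k q = beyond-col (suc n) m k (s≤s z≤n) (subst (_< k) (sym (twice-suc n)) q)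

  last-column-zero : ∀ n m → 1 ≤ n → f n m (twice n) ≡ 0ℤ
  last-column-zero (suc (suc n)) m _ = trans (cong (f (2 + n) m) (twice-suc (suc n))) (last-column (suc n) m (s≤s z≤n))
  last-column-zero (suc zero) zero p = row-zero 1 2 p
  last-column-zero (suc zero) (suc zero) _ = f-entry M₁-12
  last-column-zero (suc zero) (suc (suc zero)) _ = f-entry M₁-22
  last-column-zero (suc zero) (suc (suc (suc m))) p = beyond-row 1 _ 2 p (s≤s (s≤s (s≤s z≤n)))

  Below : (ℕ → Set) → ℕ → Set
  Below P zero    = ⊤
  Below P (suc n) = 1 ≤ n → P n

  RowRecurrence : ℕ → Set
  RowRecurrence n = ∀ k → 1 ≤ k → suc k ≤ twice n →
                    Poupard (R n (2 + k)) (R n (1 + k)) (R n k) (f n (twice n) k)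

  SumRecurrence : ℕ → Set
  SumRecurrence n = ∀ k → 1 ≤ k → k ≤ twice n →
                    Poupard (S (suc n) (2 + k)) (S (suc n) (1 + k)) (S (suc n) k) (f (suc n) (1 + twice n) k)

  fᵀ : ℕ → ℕ → ℕ → ℤ
  fᵀ n m k = f n k m

  module Lower = Relations f
  module Upper = Relations fᵀ

  -- The Poupard relations along the rows of M_{n+1} below the diagonal; they are what the
  -- theorem asserts.  By transposition, the ones along the columns above the diagonal.
  LowerRelations : ℕ → Set
  LowerRelations n = ∀ k M → 1 ≤ k → k < M → Lower.Horizontal n k M

  UpperRelations : ℕ → Set
  UpperRelations n = ∀ m K → 1 ≤ m → m < K → Upper.Horizontal n m K

  -- Rows 2n+2 and 2n+1 of M_{n+1} start the lower relations: there they are the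
  -- recurrences of R_n and of S_n.
  lower-at-last-row : ∀ n k → 1 ≤ n → 1 ≤ k → k < twice n → RowRecurrence n → Lower.Horizontal n k (twice n)
  lower-at-last-row n k p 1≤k k<2n rec =
    poupard-cong (last-row n (2 + k) p (s≤s z≤n)) (last-row n (1 + k) p (s≤s z≤n)) (last-row n k p 1≤k) refl
                 (rec k 1≤k k<2n)

  lower-at-row-before-last : ∀ n k M → 1 ≤ k → Below SumRecurrence n → suc M ≡ twice n → k < M →
                             Lower.Horizontal n k M
  lower-at-row-before-last (suc zero) k .1 (s≤s z≤n) _ refl (s≤s ())
  lower-at-row-before-last (suc (suc n)) k M 1≤k sums e k<M =
    poupard-cong (row-at (2 + k) (s≤s z≤n)) (row-at (1 + k) (s≤s z≤n)) (row-at k 1≤k) (cong (λ x → f (2 + n) x k) M≡)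
                 (sums (s≤s z≤n) k 1≤k (≤-pred (subst (k <_) M≡ k<M)))
    where
      M≡ : M ≡ 1 + twice (suc n)
      M≡ = cong (λ x → x ∸ 1) (trans e (twice-suc (suc n)))
      row-at : ∀ c → 1 ≤ c → f (3 + n) (2 + M) c ≡ S (2 + n) c
      row-at c q = trans (cong (λ x → f (3 + n) (suc x) c) e)
                         (row-before-last (2 + n) c (s≤s z≤n) q)

  -- Below row 2n + 1 the lower relations descend by the commutation of second differences,
  -- using those of the previous level.
  lower-step : ∀ n k M → 1 ≤ k → Below LowerRelations n → 2 + M ≤ twice n → k < M →
               Lower.Horizontal n k (1 + M) → Lower.Horizontal n k (2 + M) → Lower.Horizontal n k M
  lower-step (suc zero) k zero _ _ _ () _ _
  lower-step (suc zero) k (suc M) _ _ (s≤s (s≤s ())) _ _ _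
  lower-step (suc (suc n)) k M 1≤k below le k<M h₁ h₂ =
    Lower.horizontal-step (suc n) k M
      (lower-recurrence (2 + n) (2 + M) (2 + k) (s≤s z≤n) (s≤s z≤n) (s≤s (s≤s k<M)) le)
      (lower-recurrence (2 + n) (2 + M) (1 + k) (s≤s z≤n) (s≤s z≤n) (s≤s (≤-trans k<M (n≤1+n M))) le)
      (lower-recurrence (2 + n) (2 + M) k (s≤s z≤n) 1≤k (≤-trans k<M (≤-trans (n≤1+n M) (n≤1+n (suc M)))) le)
      (lower-recurrence (suc n) M k (s≤s z≤n) 1≤k k<M (≤-pred (≤-pred (subst (2 + M ≤_) (twice-suc (suc n)) le))))
      (below (s≤s z≤n) k M 1≤k k<M) h₁ h₂

  lower-relations : ∀ n → 1 ≤ n → RowRecurrence n → Below SumRecurrence n → Below LowerRelations n →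
                    LowerRelations n
  lower-relations n p rec sums below k M 1≤k k<M with M ≤? twice n
  ... | no M≰2n = poupard-zeros (beyond (2 + k)) (beyond (1 + k)) (beyond k) (beyond-row n M k p (≰⇒> M≰2n))
    where
      beyond : ∀ c → f (suc n) (2 + M) c ≡ 0ℤ
      beyond c = beyond-row-next n (2 + M) c (s≤s (s≤s (≰⇒> M≰2n)))
  ... | yes M≤2n = downward (λ M → k < M → Lower.Horizontal n k M) (twice n)
                     (λ k<2n → lower-at-last-row n k p 1≤k k<2n rec)
                     (λ M e → lower-at-row-before-last n k M 1≤k sums e)
                     (λ M le h₁ h₂ k<M → lower-step n k M 1≤k below le k<M (h₁ (≤-trans k<M (n≤1+n M)))
                                           (h₂ (≤-trans k<M (≤-trans (n≤1+n M) (n≤1+n (suc M))))))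
                     M M≤2n k<M

  -- Columns 2n+2 and 2n+1 of M_{n+1} start the upper relations: there they are trivial,
  -- resp. the recurrence of R_n.
  upper-at-last-column : ∀ n m → 1 ≤ n → Upper.Horizontal n m (twice n)
  upper-at-last-column n m p =
    poupard-zeros (last-column n (2 + m) p) (last-column n (1 + m) p) (last-column n m p) (last-column-zero n m p)

  upper-at-column-before-last : ∀ n m K → 1 ≤ m → RowRecurrence n → suc K ≡ twice n → m < K →
                                Upper.Horizontal n m K
  upper-at-column-before-last (suc zero) (suc m) .1 _ _ refl (s≤s ())
  upper-at-column-before-last (suc (suc n)) m K 1≤m rec e m<K =
    poupard-cong (column-at (2 + m) (s≤s z≤n)) (column-at (1 + m) (s≤s z≤n)) (column-at m 1≤m) weight
                 (rec m 1≤m (subst (suc m ≤_) e (≤-trans m<K (n≤1+n K))))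
    where
      K≡ : K ≡ 1 + twice (suc n)
      K≡ = cong (λ x → x ∸ 1) (trans e (twice-suc (suc n)))
      column-at : ∀ r → 1 ≤ r → f (3 + n) r (2 + K) ≡ R (2 + n) r
      column-at r q = trans (cong (λ x → f (3 + n) r (suc x)) e) (column-before-last (2 + n) r (s≤s z≤n) q)
      weight : f (2 + n) m K ≡ f (2 + n) (twice (2 + n)) m
      weight = begin
        f (2 + n) m K                     ≡⟨ cong (f (2 + n) m) K≡ ⟩
        f (2 + n) m (1 + twice (suc n))   ≡⟨ column-before-last (suc n) m (s≤s z≤n) 1≤m ⟩
        R (suc n) m                       ≡⟨ sym (last-row (suc n) m (s≤s z≤n) 1≤m) ⟩
        f (2 + n) (2 + twice (suc n)) m   ≡⟨ cong (λ x → f (2 + n) x m) (sym (twice-suc (suc n))) ⟩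
        f (2 + n) (twice (2 + n)) m       ∎
        where open ≡-Reasoning

  upper-step : ∀ n m K → 1 ≤ m → Below UpperRelations n → 2 + K ≤ twice n → m < K →
               Upper.Horizontal n m (1 + K) → Upper.Horizontal n m (2 + K) → Upper.Horizontal n m K
  upper-step (suc zero) m zero _ _ _ () _ _
  upper-step (suc zero) m (suc K) _ _ (s≤s (s≤s ())) _ _ _
  upper-step (suc (suc n)) m K 1≤m below le m<K h₁ h₂ =
    Upper.horizontal-step (suc n) m K
      (upper-recurrence (2 + n) (2 + m) (2 + K) (s≤s z≤n) (s≤s z≤n) (s≤s (s≤s m<K)) le)
      (upper-recurrence (2 + n) (1 + m) (2 + K) (s≤s z≤n) (s≤s z≤n) (s≤s (≤-trans m<K (n≤1+n K))) le)
      (upper-recurrence (2 + n) m (2 + K) (s≤s z≤n) 1≤m (≤-trans m<K (≤-trans (n≤1+n K) (n≤1+n (suc K)))) le)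
      (upper-recurrence (suc n) m K (s≤s z≤n) 1≤m m<K (≤-pred (≤-pred (subst (2 + K ≤_) (twice-suc (suc n)) le))))
      (below (s≤s z≤n) m K 1≤m m<K) h₁ h₂

  upper-relations : ∀ n → 1 ≤ n → RowRecurrence n → Below UpperRelations n → UpperRelations n
  upper-relations n p rec below m K 1≤m m<K with K ≤? twice n
  ... | no K≰2n = poupard-zeros (beyond (2 + m)) (beyond (1 + m)) (beyond m) (beyond-col n m K p (≰⇒> K≰2n))
    where
      beyond : ∀ r → f (suc n) r (2 + K) ≡ 0ℤ
      beyond r = beyond-col-next n r (2 + K) (s≤s (s≤s (≰⇒> K≰2n)))
  ... | yes K≤2n = downward (λ K → m < K → Upper.Horizontal n m K) (twice n)
                     (λ _ → upper-at-last-column n m p)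
                     (λ K e → upper-at-column-before-last n m K 1≤m rec e)
                     (λ K le h₁ h₂ m<K → upper-step n m K 1≤m below le m<K (h₁ (≤-trans m<K (n≤1+n K)))
                                           (h₂ (≤-trans m<K (≤-trans (n≤1+n K) (n≤1+n (suc K))))))
                     K K≤2n m<K

  FirstRowZero : ℕ → Set
  FirstRowZero n = ∀ k → f n 1 k ≡ 0ℤ

  CornerSums : ℕ → Set
  CornerSums n = C n 1 ≡ R n 2

  -- Row 2 and columns 1 and 2 of M_{n+1} hold the row sums, resp. the totals, of M_n in
  -- reverse order: position k of the line carries index j = 2n + 3 − k.
  SecondRow : ℕ → Set
  SecondRow n = ∀ j k → k + j ≡ 3 + twice n → 3 ≤ k → f (suc n) 2 k ≡ R n j

  FirstColumn : ℕ → Set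
  FirstColumn n = ∀ j m → m + j ≡ 3 + twice n → 2 ≤ m → f (suc n) m 1 ≡ R n j

  SecondColumn : ℕ → Set
  SecondColumn n = ∀ j m → m + j ≡ 3 + twice n → 3 ≤ m → f (suc n) m 2 ≡ S n j

  R-first-row : ∀ n → FirstRowZero n → R n 1 ≡ 0ℤ
  R-first-row n row₁ = trans (R-sum n 1) (Σℤ-zero (twice n) (λ t _ → row₁ (suc t)))

  -- If the first row of M_n vanishes, so does that of M_{n+1}: going down from the last two
  -- columns, the upper recurrence along row 1 has vanishing weights.
  first-row-next : ∀ n → 1 ≤ n → FirstRowZero n → FirstRowZero (suc n)
  first-row-next n p row₁ k with k ≤? 2 + twice n
  ... | no k≰ = beyond-col-next n 1 k (≰⇒> k≰)
  ... | yes k≤ = downward (λ k → f (suc n) 1 k ≡ 0ℤ) (2 + twice n) (last-column n 1 p) at-before-last step k k≤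
    where
      at-before-last : ∀ k → suc k ≡ 2 + twice n → f (suc n) 1 k ≡ 0ℤ
      at-before-last k refl = trans (column-before-last n 1 p ≤-refl) (R-first-row n row₁)
      step : ∀ k → 2 + k ≤ 2 + twice n → f (suc n) 1 (1 + k) ≡ 0ℤ → f (suc n) 1 (2 + k) ≡ 0ℤ → f (suc n) 1 k ≡ 0ℤ
      step zero _ _ _ = col-zero (suc n) 1 (s≤s z≤n)
      step (suc zero) _ _ _ = diagonal (suc n) 1 (s≤s z≤n)
      step (suc (suc k)) le z₁ z₂ =
        poupard-unique (poupard-cong (sym z₂) (sym z₁) refl (sym (row₁ (2 + k))) (upper-recurrence n 1 (2 + k) p ≤-refl (s≤s (s≤s z≤n)) (≤-pred (≤-pred le))))
                       (poupard-zeros refl refl refl refl)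

  S-one : ∀ n → FirstRowZero n → CornerSums n → S n 1 ≡ R n 2
  S-one n row₁ corner = trans (cong₂ _+ℤ_ (R-first-row n row₁) corner) (ℤP.+-identityˡ (R n 2))

  -- Facts about the previous level turning an entry of row 2, column 1 or column 2 of M_n
  -- into an entry of its last two rows; they supply the weights of the recurrences below.
  second-row-below : ∀ n k t → Below SecondRow n → 3 ≤ k → k + t ≡ twice n → f n 2 k ≡ f n (twice n) (1 + t)
  second-row-below zero k t _ 3≤k e = ⊥-elim (beyond-length (≤-trans (s≤s z≤n) 3≤k) e)
  second-row-below (suc zero) k t _ 3≤k e = ⊥-elim (beyond-length 3≤k e)
  second-row-below (suc (suc n)) k t below 3≤k e =
    trans (below (s≤s z≤n) (1 + t) k (trans (+-suc k t) (cong suc (trans e (twice-suc (suc n))))) 3≤k)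
          (sym (trans (cong (λ x → f (2 + n) x (1 + t)) (twice-suc (suc n))) (last-row (suc n) (1 + t) (s≤s z≤n) (s≤s z≤n))))

  first-column-below : ∀ n m t → Below FirstColumn n → 2 ≤ m → m + t ≡ twice n → f n m 1 ≡ f n (twice n) (1 + t)
  first-column-below zero m t _ 2≤m e = ⊥-elim (beyond-length (≤-trans (s≤s z≤n) 2≤m) e)
  first-column-below (suc zero) (suc (suc zero)) zero _ _ refl = refl
  first-column-below (suc zero) (suc (suc (suc m))) t _ _ e = ⊥-elim (beyond-length {3 + m} {t} (s≤s (s≤s (s≤s z≤n))) e)
  first-column-below (suc zero) (suc zero) t _ (s≤s ()) e
  first-column-below (suc (suc n)) m t below 2≤m e =
    trans (below (s≤s z≤n) (1 + t) m (trans (+-suc m t) (cong suc (trans e (twice-suc (suc n))))) 2≤m)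
          (sym (trans (cong (λ x → f (2 + n) x (1 + t)) (twice-suc (suc n))) (last-row (suc n) (1 + t) (s≤s z≤n) (s≤s z≤n))))

  second-column-below : ∀ n m t → 1 ≤ n → SecondColumn n → 3 ≤ m → m + t ≡ 2 + twice n →
                        f (suc n) m 2 ≡ f (suc n) (1 + twice n) (1 + t)
  second-column-below n m t p col₂ 3≤m e =
    trans (col₂ (1 + t) m (trans (+-suc m t) (cong suc e)) 3≤m) (sym (row-before-last n (1 + t) p (s≤s z≤n)))

  -- Row 2 of M_{n+1}, from its end: the upper recurrence along it has the weights of the
  -- recurrence of R_n, read backwards.
  second-row : ∀ n → 1 ≤ n → FirstRowZero n → RowRecurrence n → Below SecondRow n → SecondRow n
  second-row n p row₁ rec below zero k e _ =
    trans (beyond-col-next n 2 k (subst (2 + twice n <_) (sym (position k 0 (3 + twice n) e)) ≤-refl)) (sym (R-zero n p))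
  second-row n p row₁ rec below (suc j) = two-step P at-1 at-2 step j
    where
      P : ℕ → Set
      P j = ∀ k → k + suc j ≡ 3 + twice n → 3 ≤ k → f (suc n) 2 k ≡ R n (suc j)
      at-1 : P 0
      at-1 k e _ rewrite position k 1 (2 + twice n) e = trans (last-column n 2 p) (sym (R-first-row n row₁))
      at-2 : P 1
      at-2 k e _ rewrite position k 2 (1 + twice n) e = column-before-last n 2 p (s≤s z≤n)
      step : ∀ t → P t → P (suc t) → P (2 + t)
      step t at-t+1 at-t+2 k e 3≤k =
        poupard-mirror (poupard-cong refl refl refl (sym (second-row-below n k t below 3≤k k+t))
                         (upper-recurrence n 2 k p (s≤s z≤n) 3≤k (subst (k ≤_) k+t (m≤m+n k t))))
                       (rec (1 + t) (s≤s z≤n) (subst (2 + t ≤_) k+t (+-monoˡ-≤ t (≤-trans (n≤1+n 2) 3≤k))))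
                       (at-t+1 (2 + k) (shift-sum 2 1 k t (twice n) k+t) (≤-trans 3≤k (≤-trans (n≤1+n k) (n≤1+n (suc k)))))
                       (at-t+2 (1 + k) (shift-sum 1 2 k t (twice n) k+t) (≤-trans 3≤k (n≤1+n k)))
        where
          k+t : k + t ≡ twice n
          k+t = drop-sum 3 k t (twice n) e

  first-column : ∀ n → 1 ≤ n → FirstRowZero n → CornerSums n → RowRecurrence n → Below FirstColumn n →
                 FirstColumn n
  first-column n p row₁ corner rec below zero m e _ =
    trans (beyond-row-next n m 1 (subst (2 + twice n <_) (sym (position m 0 (3 + twice n) e)) ≤-refl)) (sym (R-zero n p))
  first-column n p row₁ corner rec below (suc j) = two-step P at-1 at-2 step j
    where
      P : ℕ → Set
      P j = ∀ m → m + suc j ≡ 3 + twice n → 2 ≤ m → f (suc n) m 1 ≡ R n (suc j)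
      at-1 : P 0
      at-1 m e _ rewrite position m 1 (2 + twice n) e = last-row n 1 p ≤-refl
      at-2 : P 1
      at-2 m e _ rewrite position m 2 (1 + twice n) e = trans (row-before-last n 1 p ≤-refl) (S-one n row₁ corner)
      step : ∀ t → P t → P (suc t) → P (2 + t)
      step t at-t+1 at-t+2 m e 2≤m =
        poupard-mirror (poupard-cong refl refl refl (sym (first-column-below n m t below 2≤m m+t))
                         (lower-recurrence n m 1 p ≤-refl 2≤m (subst (m ≤_) m+t (m≤m+n m t))))
                       (rec (1 + t) (s≤s z≤n) (subst (2 + t ≤_) m+t (+-monoˡ-≤ t 2≤m)))
                       (at-t+1 (2 + m) (shift-sum 2 1 m t (twice n) m+t) (≤-trans 2≤m (≤-trans (n≤1+n m) (n≤1+n (suc m)))))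
                       (at-t+2 (1 + m) (shift-sum 1 2 m t (twice n) m+t) (≤-trans 2≤m (n≤1+n m)))
        where
          m+t : m + t ≡ twice n
          m+t = drop-sum 3 m t (twice n) e

  -- Column 2 of M_{n+1}, from its end; along it the lower recurrence carries the weights of
  -- the recurrence of S_n, read backwards.
  second-column-step : ∀ n t m → Below SumRecurrence n → Below SecondColumn n → m + t ≡ twice n → 3 ≤ m →
                       f (suc n) (2 + m) 2 ≡ S n (1 + t) → f (suc n) (1 + m) 2 ≡ S n (2 + t) →
                       f (suc n) m 2 ≡ S n (3 + t)
  second-column-step zero t m _ _ e 3≤m _ _ = ⊥-elim (beyond-length (≤-trans (s≤s z≤n) 3≤m) e)
  second-column-step (suc zero) t m _ _ e 3≤m _ _ = ⊥-elim (beyond-length 3≤m e)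
  second-column-step (suc (suc n)) t m sums below e 3≤m at-t+1 at-t+2 =
    poupard-mirror (poupard-cong refl refl refl (sym weight)
                     (lower-recurrence (2 + n) m 2 (s≤s z≤n) (s≤s z≤n) 3≤m (subst (m ≤_) e (m≤m+n m t))))
                   (sums (s≤s z≤n) (1 + t) (s≤s z≤n) (≤-pred (≤-pred (subst (3 + t ≤_) e′ (+-monoˡ-≤ t 3≤m)))))
                   at-t+1 at-t+2
    where
      e′ : m + t ≡ 2 + twice (suc n)
      e′ = trans e (twice-suc (suc n))
      weight : f (2 + n) m 2 ≡ f (2 + n) (1 + twice (suc n)) (1 + t)
      weight = second-column-below (suc n) m t (s≤s z≤n) (below (s≤s z≤n)) 3≤m e′

  second-column : ∀ n → 1 ≤ n → FirstRowZero n → CornerSums n → Below SumRecurrence n → Below SecondColumn n →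
                  SecondColumn n
  second-column n p row₁ corner sums below zero m e _ =
    trans (beyond-row-next n m 2 (subst (2 + twice n <_) (sym (position m 0 (3 + twice n) e)) ≤-refl))
          (sym (cong₂ _+ℤ_ (R-zero n p) (C-zero n p)))
  second-column n p row₁ corner sums below (suc j) = two-step P at-1 at-2 step j
    where
      P : ℕ → Set
      P j = ∀ m → m + suc j ≡ 3 + twice n → 3 ≤ m → f (suc n) m 2 ≡ S n (suc j)
      at-1 : P 0
      at-1 m e _ rewrite position m 1 (2 + twice n) e = trans (last-row n 2 p (s≤s z≤n)) (sym (S-one n row₁ corner))
      at-2 : P 1
      at-2 m e _ rewrite position m 2 (1 + twice n) e = row-before-last n 2 p (s≤s z≤n)
      step : ∀ t → P t → P (suc t) → P (2 + t)
      step t at-t+1 at-t+2 m e 3≤m =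
        second-column-step n t m sums below m+t 3≤m
          (at-t+1 (2 + m) (shift-sum 2 1 m t (twice n) m+t) (≤-trans 3≤m (≤-trans (n≤1+n m) (n≤1+n (suc m)))))
          (at-t+2 (1 + m) (shift-sum 1 2 m t (twice n) m+t) (≤-trans 3≤m (n≤1+n m)))
        where
          m+t : m + t ≡ twice n
          m+t = drop-sum 3 m t (twice n) e

  Duality : ℕ → Set
  Duality n = ∀ m j → m + j ≡ suc (twice n) → R n m ≡ C n j

  row-around : ∀ n a u → twice n ≡ suc a + u →
               R n (suc a) ≡ Σℤ a (λ t → f n (suc a) (suc t)) +ℤ f n (suc a) (suc a) +ℤ Σℤ u (λ t → f n (suc a) (2 + a + t))
  row-around n a u e = trans (R-sum n (suc a)) (trans (cong (λ L → Σℤ L (λ t → f n (suc a) (suc t))) (trans e (sym (+-suc a u))))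
                                                      (Σℤ-around a u (λ t → f n (suc a) (suc t))))

  column-around : ∀ n a u → twice n ≡ suc a + u →
                  C n (suc a) ≡ Σℤ a (λ t → f n (suc t) (suc a)) +ℤ f n (suc a) (suc a) +ℤ Σℤ u (λ t → f n (2 + a + t) (suc a))
  column-around n a u e = trans (C-sum n (suc a)) (trans (cong (λ L → Σℤ L (λ t → f n (suc t) (suc a))) (trans e (sym (+-suc a u))))
                                                         (Σℤ-around a u (λ t → f n (suc t) (suc a))))

  -- The corner balance at the diagonal block of M_{n+1} at k = a + 1, with 2n = k + u:
  -- splitting R_n(k), resp. C_n(k), at the diagonal, the two parts telescope along row k + 2
  -- and row k, resp. column k + 2 and column k, of M_{n+1}; duality closes the computation.
  corner-balance-rows : ∀ n a u → 1 ≤ n → twice n ≡ suc a + u →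
    LowerRelations n → FirstColumn n → SecondColumn n → Duality n →
    f (suc n) (3 + a) (suc a) +ℤ f (suc n) (suc a) (3 + a) ≡ f (suc n) (3 + a) (2 + a) +ℤ f (suc n) (suc a) (2 + a)
  corner-balance-rows n a u p e lower col₁ col₂ dual =
    balance-algebra (Σℤ a (λ t → f n k (suc t))) (Σℤ u (λ t → f n k (2 + a + t)))
                    (f N (2 + k) k) (f N (2 + k) (1 + k)) (f N (2 + k) 1) (f N k (2 + k + u)) (f N k (1 + k)) (f N k (2 + k))
                    (row-around n a u e) (diagonal n k p) edge-left edge-right
      (poupard-telescope a (λ t → f N (2 + k) (1 + t)) (λ t → f n k (1 + t))
         (λ t t<a → lower (1 + t) k (s≤s z≤n) (s≤s t<a)))
      (tail-telescope k u (f N k) (λ t → f n k (suc k + t))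
         (λ t t<u → upper-recurrence n k (suc k + t) p (s≤s z≤n) (s≤s (m≤m+n k t)) (within t t<u)))
    where
      k N : ℕ
      k = suc a
      N = suc n
      k+u : k + u ≡ twice n
      k+u = sym e
      within : ∀ t → t < u → suc k + t ≤ twice n
      within t t<u = subst (suc k + t ≤_) k+u (subst (_≤ k + u) (+-suc k t) (+-monoʳ-≤ k t<u))
      edge-left : f N (2 + k) 2 ≡ f N (2 + k) 1 +ℤ R n k
      edge-left = begin
        f N (2 + k) 2                       ≡⟨ col₂ (1 + u) (2 + k) (shift-sum 2 1 k u (twice n) k+u) (s≤s (s≤s (s≤s z≤n))) ⟩
        R n (1 + u) +ℤ C n (1 + u)          ≡⟨ cong₂ _+ℤ_ (sym (col₁ (1 + u) (2 + k) (shift-sum 2 1 k u (twice n) k+u) (s≤s (s≤s z≤n))))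
                                                          (sym (dual k (1 + u) (trans (+-suc k u) (cong suc k+u)))) ⟩
        f N (2 + k) 1 +ℤ R n k              ∎
        where open ≡-Reasoning
      edge-right : f N k (1 + k + u) ≡ f N k (2 + k + u) +ℤ R n k
      edge-right = begin
        f N k (1 + k + u)                   ≡⟨ cong (λ x → f N k (suc x)) k+u ⟩
        f N k (1 + twice n)                 ≡⟨ column-before-last n k p (s≤s z≤n) ⟩
        R n k                               ≡⟨ sym (ℤP.+-identityˡ (R n k)) ⟩
        0ℤ +ℤ R n k                         ≡⟨ cong (_+ℤ R n k) (sym (trans (cong (λ x → f N k (2 + x)) k+u) (last-column n k p))) ⟩
        f N k (2 + k + u) +ℤ R n k          ∎
        where open ≡-Reasoning

  corner-balance-columns : ∀ n a u → 1 ≤ n → twice n ≡ suc a + u →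
    UpperRelations n → FirstRowZero (suc n) → SecondRow n → Duality n →
    f (suc n) (suc a) (3 + a) +ℤ f (suc n) (3 + a) (suc a) ≡ f (suc n) (2 + a) (3 + a) +ℤ f (suc n) (2 + a) (suc a)
  corner-balance-columns n a u p e upper row₁ row₂ dual =
    balance-algebra (Σℤ a (λ t → f n (suc t) k)) (Σℤ u (λ t → f n (2 + a + t) k))
                    (f N k (2 + k)) (f N (1 + k) (2 + k)) (f N 1 (2 + k)) (f N (2 + k + u) k) (f N (1 + k) k) (f N (2 + k) k)
                    (column-around n a u e) (diagonal n k p) edge-top edge-bottom
      (poupard-telescope a (λ t → f N (1 + t) (2 + k)) (λ t → f n (1 + t) k)
         (λ t t<a → upper (1 + t) k (s≤s z≤n) (s≤s t<a)))
      (tail-telescope k u (λ m → f N m k) (λ t → f n (suc k + t) k)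
         (λ t t<u → lower-recurrence n (suc k + t) k p (s≤s z≤n) (s≤s (m≤m+n k t)) (within t t<u)))
    where
      k N : ℕ
      k = suc a
      N = suc n
      k+u : k + u ≡ twice n
      k+u = sym e
      within : ∀ t → t < u → suc k + t ≤ twice n
      within t t<u = subst (suc k + t ≤_) k+u (subst (_≤ k + u) (+-suc k t) (+-monoʳ-≤ k t<u))
      edge-top : f N 2 (2 + k) ≡ f N 1 (2 + k) +ℤ C n k
      edge-top = begin
        f N 2 (2 + k)                       ≡⟨ row₂ (1 + u) (2 + k) (shift-sum 2 1 k u (twice n) k+u) (s≤s (s≤s (s≤s z≤n))) ⟩
        R n (1 + u)                         ≡⟨ dual (1 + u) k (trans (+-comm (1 + u) k) (trans (+-suc k u) (cong suc k+u))) ⟩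
        C n k                               ≡⟨ sym (ℤP.+-identityˡ (C n k)) ⟩
        0ℤ +ℤ C n k                         ≡⟨ cong (_+ℤ C n k) (sym (row₁ (2 + k))) ⟩
        f N 1 (2 + k) +ℤ C n k              ∎
        where open ≡-Reasoning
      edge-bottom : f N (1 + k + u) k ≡ f N (2 + k + u) k +ℤ C n k
      edge-bottom = begin
        f N (1 + k + u) k                   ≡⟨ cong (λ x → f N (suc x) k) k+u ⟩
        f N (1 + twice n) k                 ≡⟨ row-before-last n k p (s≤s z≤n) ⟩
        R n k +ℤ C n k                      ≡⟨ cong (_+ℤ C n k) (sym (trans (cong (λ x → f N (2 + x) k) k+u) (last-row n k p (s≤s z≤n)))) ⟩
        f N (2 + k + u) k +ℤ C n k          ∎
        where open ≡-Reasoning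

  ColumnRecurrence : ℕ → Set
  ColumnRecurrence n = ∀ k → 1 ≤ k → k ≤ twice n →
                       Poupard (C (suc n) (2 + k)) (C (suc n) (1 + k)) (C (suc n) k) (C n k)

  record Level (n : ℕ) : Set where
    field
      rec    : RowRecurrence n
      row₁   : FirstRowZero n
      corner : CornerSums n
      dual   : Duality n

  record Transition (n : ℕ) : Set where
    field
      lower : LowerRelations n
      upper : UpperRelations n
      row₂  : SecondRow n
      col₁  : FirstColumn n
      col₂  : SecondColumn n

  module _ (n a u : ℕ) (p : 1 ≤ n) (e : twice n ≡ suc a + u) (L : Level n) (T : Transition n)
           (row₁′ : FirstRowZero (suc n)) where
    open Level L
    open Transition T

    private
      k N : ℕ
      k = suc a
      N = suc n
      l₁₀ l₂₀ l₂₁ u₀₁ u₀₂ u₁₂ : ℤ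
      l₁₀ = f N (1 + k) k ; l₂₀ = f N (2 + k) k ; l₂₁ = f N (2 + k) (1 + k)
      u₀₁ = f N k (1 + k) ; u₀₂ = f N k (2 + k) ; u₁₂ = f N (1 + k) (2 + k)
      by-rows : l₂₀ +ℤ u₀₂ ≡ l₂₁ +ℤ u₀₁
      by-rows = corner-balance-rows n a u p e lower col₁ col₂ dual
      by-columns : u₀₂ +ℤ l₂₀ ≡ u₁₂ +ℤ l₁₀
      by-columns = corner-balance-columns n a u p e upper row₁′ row₂ dual
      zero-diagonal : ∀ m → f N m m ≡ 0ℤ
      zero-diagonal m = diagonal N m (s≤s z≤n)

    block-row-sums : Poupard (l₂₀ +ℤ l₂₁ +ℤ f N (2 + k) (2 + k)) (l₁₀ +ℤ f N (1 + k) (1 + k) +ℤ u₁₂)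
                             (f N k k +ℤ u₀₁ +ℤ u₀₂) 0ℤ
    block-row-sums = block-rows l₁₀ l₂₀ l₂₁ u₀₁ u₀₂ u₁₂ (zero-diagonal k) (zero-diagonal (1 + k)) (zero-diagonal (2 + k))
                                by-rows (trans (ℤP.+-comm l₂₀ u₀₂) (trans by-columns (ℤP.+-comm u₁₂ l₁₀)))

    block-column-sums : Poupard (u₀₂ +ℤ u₁₂ +ℤ f N (2 + k) (2 + k)) (u₀₁ +ℤ f N (1 + k) (1 + k) +ℤ l₂₁)
                                (f N k k +ℤ l₁₀ +ℤ l₂₀) 0ℤ
    block-column-sums = block-rows u₀₁ u₀₂ u₁₂ l₁₀ l₂₀ l₂₁ (zero-diagonal k) (zero-diagonal (1 + k)) (zero-diagonal (2 + k))
                                   by-columns (trans (ℤP.+-comm u₀₂ l₂₀) (trans by-rows (ℤP.+-comm l₂₁ u₀₁)))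

    -- Inside M_{n+1} (k ≤ 2n) the three lines at k, k + 1, k + 2 split at the diagonal block:
    -- before it the vertical recurrences (b)/(c) hold, after it the upper, resp. lower, relations.
    private
      k≤2n : k ≤ twice n
      k≤2n = subst (k ≤_) (sym e) (m≤m+n k u)
      length : twice N ≡ 2 + a + suc u
      length = trans (twice-suc n) (cong (λ x → 2 + x) (trans e (sym (+-suc a u))))

    row-recurrence-inner : Poupard (R N (2 + k)) (R N (1 + k)) (R N k) (f N (twice N) k)
    row-recurrence-inner =
      poupard-cong (line (2 + k)) (line (1 + k)) (line k) weight
        (split-recurrence a u (λ t → f N (2 + k) (suc t)) (λ t → f N (1 + k) (suc t)) (λ t → f N k (suc t))
                          (λ t → f n k (suc t)) (λ t → f n k (suc k + t))
                          (λ t t<a → lower-recurrence n k (suc t) p (s≤s z≤n) (s≤s t<a) k≤2n)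
                          block-row-sums
                          (λ t _ → upper k (suc k + t) (s≤s z≤n) (s≤s (m≤m+n k t))))
      where
        line : ∀ r → R N r ≡ Σℤ (2 + a + suc u) (λ t → f N r (suc t))
        line r = trans (R-sum N r) (cong (λ L → Σℤ L (λ t → f N r (suc t))) length)
        weight : f N (twice N) k ≡ Σℤ a (λ t → f n k (suc t)) +ℤ 0ℤ +ℤ Σℤ u (λ t → f n k (suc k + t))
        weight = begin
          f N (twice N) k       ≡⟨ cong (λ x → f N x k) (twice-suc n) ⟩
          f N (2 + twice n) k   ≡⟨ last-row n k p (s≤s z≤n) ⟩
          R n k                 ≡⟨ row-around n a u e ⟩
          Σℤ a (λ t → f n k (suc t)) +ℤ f n k k +ℤ Σℤ u (λ t → f n k (suc k + t))
                                ≡⟨ cong (λ x → Σℤ a (λ t → f n k (suc t)) +ℤ x +ℤ Σℤ u (λ t → f n k (suc k + t))) (diagonal n k p) ⟩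
          Σℤ a (λ t → f n k (suc t)) +ℤ 0ℤ +ℤ Σℤ u (λ t → f n k (suc k + t)) ∎
          where open ≡-Reasoning

    column-recurrence-inner : Poupard (C N (2 + k)) (C N (1 + k)) (C N k) (C n k)
    column-recurrence-inner =
      poupard-cong (line (2 + k)) (line (1 + k)) (line k) weight
        (split-recurrence a u (λ t → f N (suc t) (2 + k)) (λ t → f N (suc t) (1 + k)) (λ t → f N (suc t) k)
                          (λ t → f n (suc t) k) (λ t → f n (suc k + t) k)
                          (λ t t<a → upper-recurrence n (suc t) k p (s≤s z≤n) (s≤s t<a) k≤2n)
                          block-column-sums
                          (λ t _ → lower k (suc k + t) (s≤s z≤n) (s≤s (m≤m+n k t))))
      where
        line : ∀ r → C N r ≡ Σℤ (2 + a + suc u) (λ t → f N (suc t) r)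
        line r = trans (C-sum N r) (cong (λ L → Σℤ L (λ t → f N (suc t) r)) length)
        weight : C n k ≡ Σℤ a (λ t → f n (suc t) k) +ℤ 0ℤ +ℤ Σℤ u (λ t → f n (suc k + t) k)
        weight = trans (column-around n a u e)
                       (cong (λ x → Σℤ a (λ t → f n (suc t) k) +ℤ x +ℤ Σℤ u (λ t → f n (suc k + t) k)) (diagonal n k p))

  total : ℕ → ℤ
  total n = Σℤ (twice n) (λ t → R n (suc t))

  extended-sum : ∀ n (g : ℕ → ℤ) → (∀ m → twice n < m → g m ≡ 0ℤ) →
                 Σℤ (twice (suc n)) (λ t → g (suc t)) ≡ Σℤ (twice n) (λ t → g (suc t))
  extended-sum n g z = trans (cong (λ L → Σℤ L (λ t → g (suc t))) (twice-suc n))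
                             (Σℤ-pad (twice n) (λ t → g (suc t)) (z _ ≤-refl) (z _ (n≤1+n _)))

  column-total : ∀ n → Duality n → Σℤ (twice n) (λ t → C n (suc t)) ≡ total n
  column-total n dual = Σℤ-reverse (twice n) _ _
    (λ t s e → sym (dual (suc s) (suc t) (cong suc (trans (+-suc s t) (trans (cong suc (+-comm s t)) (trans (+-comm 1 (t + s)) e))))))

  last-row-sum : ∀ n → 1 ≤ n → R (suc n) (2 + twice n) ≡ total n
  last-row-sum n p = trans (R-sum (suc n) _) (trans (Σℤ-cong (twice (suc n)) (λ t _ → last-row n (suc t) p (s≤s z≤n)))
                                                     (extended-sum n (R n) (λ m q → R-beyond n m p q)))

  row-before-last-sum : ∀ n → 1 ≤ n → Duality n → R (suc n) (1 + twice n) ≡ total n +ℤ total n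
  row-before-last-sum n p dual = begin
    R (suc n) (1 + twice n)                                     ≡⟨ R-sum (suc n) _ ⟩
    Σℤ (twice (suc n)) (λ t → f (suc n) (1 + twice n) (suc t))  ≡⟨ Σℤ-cong (twice (suc n)) (λ t _ → row-before-last n (suc t) p (s≤s z≤n)) ⟩
    Σℤ (twice (suc n)) (λ t → S n (suc t))                      ≡⟨ extended-sum n (S n) (λ m q → cong₂ _+ℤ_ (R-beyond n m p q) (C-beyond n m p q)) ⟩
    Σℤ (twice n) (λ t → S n (suc t))                            ≡⟨ Σℤ-+ (twice n) (λ t → R n (suc t)) (λ t → C n (suc t)) ⟩
    total n +ℤ Σℤ (twice n) (λ t → C n (suc t))                 ≡⟨ cong (total n +ℤ_) (column-total n dual) ⟩
    total n +ℤ total n                                          ∎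
    where open ≡-Reasoning

  column-before-last-sum : ∀ n → 1 ≤ n → C (suc n) (1 + twice n) ≡ total n
  column-before-last-sum n p = trans (C-sum (suc n) _) (trans (Σℤ-cong (twice (suc n)) (λ t _ → column-before-last n (suc t) p (s≤s z≤n)))
                                                              (extended-sum n (R n) (λ m q → R-beyond n m p q)))

  last-column-sum : ∀ n → 1 ≤ n → C n (twice n) ≡ 0ℤ
  last-column-sum n p = trans (C-sum n _) (Σℤ-zero (twice n) (λ t _ → last-column-zero n (suc t) p))

  row-recurrence-top : ∀ n → 1 ≤ n → Duality n →
                       Poupard (R (suc n) (3 + twice n)) (R (suc n) (2 + twice n)) (R (suc n) (1 + twice n))
                               (f (suc n) (twice (suc n)) (1 + twice n))
  row-recurrence-top n p dual =
    poupard-cong (R-beyond (suc n) _ (s≤s z≤n) (subst (_< 3 + twice n) (sym (twice-suc n)) ≤-refl))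
                 (last-row-sum n p) (row-before-last-sum n p dual) weight (poupard-top (total n))
    where
      weight : f (suc n) (twice (suc n)) (1 + twice n) ≡ 0ℤ
      weight = trans (cong (λ x → f (suc n) x (1 + twice n)) (twice-suc n))
                     (trans (last-row n (1 + twice n) p (s≤s z≤n)) (R-beyond n _ p ≤-refl))

  row-recurrence-next : ∀ n → 1 ≤ n → Level n → Transition n → RowRecurrence (suc n)
  row-recurrence-next n p L T (suc a) _ k<2N with suc a ≤? twice n
  ... | yes k≤2n with m≤n⇒∃[o]m+o≡n k≤2n
  ...   | u , e = row-recurrence-inner n a u p (sym e) L T (first-row-next n p (Level.row₁ L))
  row-recurrence-next n p L T (suc a) _ k<2N | no k≰2n
    with ≤-antisym (≤-pred (≤-pred (subst (2 + a ≤_) (twice-suc n) k<2N))) (≤-pred (≰⇒> k≰2n))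
  ... | refl = row-recurrence-top n p (Level.dual L)

  column-recurrence : ∀ n → 1 ≤ n → Level n → Transition n → ColumnRecurrence n
  column-recurrence n p L T (suc a) _ k≤2n with m≤n⇒∃[o]m+o≡n k≤2n
  ... | u , e = column-recurrence-inner n a u p (sym e) L T (first-row-next n p (Level.row₁ L))

  sum-recurrence : ∀ n → 1 ≤ n → Level n → Transition n → SumRecurrence n
  sum-recurrence n p L T k 1≤k k≤2n =
    poupard-cong refl refl refl weight
      (poupard-add (row-recurrence-next n p L T k 1≤k (≤-trans (s≤s k≤2n) (≤-trans (n≤1+n _) (≤-reflexive (sym (twice-suc n))))))
                   (column-recurrence n p L T k 1≤k k≤2n))
    where
      weight : f (suc n) (1 + twice n) k ≡ f (suc n) (twice (suc n)) k +ℤ C n k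
      weight = trans (row-before-last n k p 1≤k)
                     (cong (_+ℤ C n k) (sym (trans (cong (λ x → f (suc n) x k) (twice-suc n)) (last-row n k p 1≤k))))

  -- Column 1 and row 2 of M_{n+1} both sum to the total of M_n (read backwards), so the
  -- corner sums agree at level n + 1.
  first-column-sum : ∀ n → 1 ≤ n → Transition n → C (suc n) 1 ≡ total n
  first-column-sum n p T = begin
    C N 1                                                     ≡⟨ C-sum N 1 ⟩
    Σℤ (twice N) (λ t → f N (suc t) 1)                        ≡⟨ cong (λ L → Σℤ L (λ t → f N (suc t) 1)) (twice-suc n) ⟩
    Σℤ (2 + twice n) (λ t → f N (suc t) 1)                    ≡⟨ Σℤ-peel (1 + twice n) (λ t → f N (suc t) 1) ⟩
    f N 1 1 +ℤ Σℤ (1 + twice n) (λ t → f N (2 + t) 1)         ≡⟨ cong₂ _+ℤ_ (diagonal N 1 (s≤s z≤n))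
                                                                   (Σℤ-reverse (1 + twice n) _ _ (λ t s e →
                                                                      Transition.col₁ T (suc s) (2 + t) (mirror-index 2 t s _ e) (s≤s (s≤s z≤n)))) ⟩
    0ℤ +ℤ Σℤ (1 + twice n) (λ t → R n (suc t))                ≡⟨ ℤP.+-identityˡ _ ⟩
    total n +ℤ R n (1 + twice n)                              ≡⟨ cong (total n +ℤ_) (R-beyond n _ p ≤-refl) ⟩
    total n +ℤ 0ℤ                                             ≡⟨ ℤP.+-identityʳ (total n) ⟩
    total n                                                   ∎
    where
      open ≡-Reasoning
      N : ℕ
      N = suc n

  second-row-sum : ∀ n → 1 ≤ n → Transition n → R (suc n) 2 ≡ total n
  second-row-sum n p T = begin
    R N 2                                                     ≡⟨ R-sum N 2 ⟩
    Σℤ (twice N) (λ t → f N 2 (suc t))                        ≡⟨ cong (λ L → Σℤ L (λ t → f N 2 (suc t))) (twice-suc n) ⟩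
    Σℤ (2 + twice n) (λ t → f N 2 (suc t))                    ≡⟨ Σℤ-peel (1 + twice n) (λ t → f N 2 (suc t)) ⟩
    f N 2 1 +ℤ Σℤ (1 + twice n) (λ t → f N 2 (2 + t))         ≡⟨ cong (f N 2 1 +ℤ_) (Σℤ-peel (twice n) (λ t → f N 2 (2 + t))) ⟩
    f N 2 1 +ℤ (f N 2 2 +ℤ Σℤ (twice n) (λ t → f N 2 (3 + t)))
      ≡⟨ cong₂ (λ x y → x +ℤ (y +ℤ Σℤ (twice n) (λ t → f N 2 (3 + t))))
               (trans (Transition.col₁ T (1 + twice n) 2 refl ≤-refl) (R-beyond n _ p ≤-refl)) (diagonal N 2 (s≤s z≤n)) ⟩
    0ℤ +ℤ (0ℤ +ℤ Σℤ (twice n) (λ t → f N 2 (3 + t)))          ≡⟨ trans (ℤP.+-identityˡ _) (ℤP.+-identityˡ _) ⟩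
    Σℤ (twice n) (λ t → f N 2 (3 + t))                        ≡⟨ Σℤ-reverse (twice n) _ _ (λ t s e →
                                                                   Transition.row₂ T (suc s) (3 + t) (mirror-index 3 t s _ e) (s≤s (s≤s (s≤s z≤n)))) ⟩
    total n                                                   ∎
    where
      open ≡-Reasoning
      N : ℕ
      N = suc n

  corner-sums-next : ∀ n → 1 ≤ n → Transition n → CornerSums (suc n)
  corner-sums-next n p T = trans (first-column-sum n p T) (sym (second-row-sum n p T))

  -- Duality for M_{n+1}: R_{n+1}(m) = C_{n+1}(2n + 3 − m), upwards in m, the recurrences of
  -- the row sums and of the column sums sharing their weights R_n(m − 2) = C_n(2n + 3 − m).
  duality-next : ∀ n → 1 ≤ n → Level n → Transition n → Duality (suc n)
  duality-next n p L T zero j e =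
    trans (R-zero N (s≤s z≤n)) (sym (C-beyond N j (s≤s z≤n) (subst (twice N <_) (sym e) ≤-refl)))
    where
      N : ℕ
      N = suc n
  duality-next n p L T (suc m) = two-step P at-1 at-2 step m
    where
      N : ℕ
      N = suc n
      P : ℕ → Set
      P m = ∀ j → suc m + j ≡ suc (twice N) → R N (suc m) ≡ C N j
      at-1 : P 0
      at-1 j refl = trans (R-first-row N (first-row-next n p (Level.row₁ L))) (sym (last-column-sum N (s≤s z≤n)))
      at-2 : P 1
      at-2 j e = trans (second-row-sum n p T)
                       (sym (trans (cong (C N) (+-cancelˡ-≡ 2 j (1 + twice n) (trans e (cong suc (twice-suc n)))))
                                   (column-before-last-sum n p)))
      step : ∀ t → P t → P (suc t) → P (2 + t)
      step t _ _ zero e =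
        trans (R-beyond N (3 + t) (s≤s z≤n) (subst (twice N <_) (sym (trans (sym (+-identityʳ (3 + t))) e)) ≤-refl))
              (sym (C-zero N (s≤s z≤n)))
      step t ih₀ ih₁ (suc j) e =
        sym (poupard-mirror (column-recurrence n p L T j′ (s≤s z≤n) (subst (j′ ≤_) t+j′ (m≤n+m j′ t)))
                            (poupard-cong refl refl refl (sym weight)
                              (row-recurrence-next n p L T (1 + t) (s≤s z≤n) (subst (2 + t ≤_) (sym (twice-suc n))
                                                                                       (s≤s (s≤s (subst (t ≤_) t+j′ (m≤m+n t j′)))))))
                            (sym (ih₀ (2 + j′) (trans (shift-sum 1 2 t j′ (twice n) t+j′) (sym (cong suc (twice-suc n))))))
                            (sym (ih₁ (1 + j′) (trans (shift-sum 2 1 t j′ (twice n) t+j′) (sym (cong suc (twice-suc n)))))))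
        where
          j′ : ℕ
          j′ = suc j
          t+j′ : t + j′ ≡ twice n
          t+j′ = cong (λ x → x ∸ 3) (trans e (cong suc (twice-suc n)))
          weight : f N (twice N) (1 + t) ≡ C n j′
          weight = trans (cong (λ x → f N x (1 + t)) (twice-suc n))
                         (trans (last-row n (1 + t) p (s≤s z≤n)) (Level.dual L (1 + t) j′ (cong suc t+j′)))

  level-one : Level 1
  level-one = record { rec = rec₁ ; row₁ = row₁-one ; corner = corner₁ ; dual = dual₁ }
    where
      one : 1 ≤ 1
      one = s≤s z≤n
      R₁₁ : R 1 1 ≡ 0ℤ
      R₁₁ = trans (R-sum 1 1) (cong₂ (λ x y → 0ℤ +ℤ x +ℤ y) (f-entry M₁-11) (f-entry M₁-12))
      R₁₂ : R 1 2 ≡ + 1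
      R₁₂ = trans (R-sum 1 2) (cong₂ (λ x y → 0ℤ +ℤ x +ℤ y) (f-entry M₁-21) (f-entry M₁-22))
      C₁₁ : C 1 1 ≡ + 1
      C₁₁ = trans (C-sum 1 1) (cong₂ (λ x y → 0ℤ +ℤ x +ℤ y) (f-entry M₁-11) (f-entry M₁-21))
      C₁₂ : C 1 2 ≡ 0ℤ
      C₁₂ = trans (C-sum 1 2) (cong₂ (λ x y → 0ℤ +ℤ x +ℤ y) (f-entry M₁-12) (f-entry M₁-22))
      rec₁ : RowRecurrence 1
      rec₁ (suc zero) _ _ = poupard-cong (R-beyond 1 3 one (s≤s (s≤s (s≤s z≤n)))) R₁₂ R₁₁ (f-entry M₁-21) (poupard-expand refl)
      rec₁ (suc (suc k)) _ (s≤s (s≤s ()))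
      row₁-one : FirstRowZero 1
      row₁-one zero = col-zero 1 1 one
      row₁-one (suc zero) = f-entry M₁-11
      row₁-one (suc (suc zero)) = f-entry M₁-12
      row₁-one (suc (suc (suc k))) = beyond-col 1 1 _ one (s≤s (s≤s (s≤s z≤n)))
      corner₁ : CornerSums 1
      corner₁ = trans C₁₁ (sym R₁₂)
      dual₁ : Duality 1
      dual₁ zero _ refl = trans (R-zero 1 one) (sym (C-beyond 1 3 one ≤-refl))
      dual₁ (suc zero) _ refl = trans R₁₁ (sym C₁₂)
      dual₁ (suc (suc zero)) _ refl = sym corner₁
      dual₁ (suc (suc (suc zero))) _ refl = trans (R-beyond 1 3 one ≤-refl) (sym (C-zero 1 one))

  below-map : ∀ {P Q : ℕ → Set} → (∀ {n} → P n → Q n) → ∀ n → Below P n → Below Q n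
  below-map g zero    _ = tt
  below-map g (suc n) b q = g (b q)

  transition-at : ∀ n → 1 ≤ n → Level n → Below Transition n → Below SumRecurrence n → Transition n
  transition-at n p L below sums = record
    { lower = lower-relations n p rec sums (below-map Transition.lower n below)
    ; upper = upper-relations n p rec (below-map Transition.upper n below)
    ; row₂  = second-row n p row₁ rec (below-map Transition.row₂ n below)
    ; col₁  = first-column n p row₁ corner rec (below-map Transition.col₁ n below)
    ; col₂  = second-column n p row₁ corner sums (below-map Transition.col₂ n below)
    }
    where open Level L

  next-level : ∀ n → 1 ≤ n → Level n → Transition n → Level (suc n)
  next-level n p L T = record
    { rec    = row-recurrence-next n p L T
    ; row₁   = first-row-next n p (Level.row₁ L)
    ; corner = corner-sums-next n p T
    ; dual   = duality-next n p L T
    }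

  record Stage (n : ℕ) : Set where
    field
      level      : Level n
      transition : Transition n
      sums       : SumRecurrence n

  -- A stage from the facts about M_n and the previous stage: the transition first, then the
  -- recurrence of the totals, which needs the row recurrence of M_{n+1}.
  build : ∀ n → 1 ≤ n → Level n → Below Stage n → Stage n
  build n p L below = record { level = L ; transition = T ; sums = sum-recurrence n p L T }
    where
      T : Transition n
      T = transition-at n p L (below-map Stage.transition n below) (below-map Stage.sums n below)

  stage : ∀ n → Stage (suc n)
  stage zero    = build 1 (s≤s z≤n) level-one (λ ())
  stage (suc n) = build (2 + n) (s≤s z≤n) (next-level (suc n) (s≤s z≤n) (Stage.level (stage n)) (Stage.transition (stage n)))
                        (λ _ → stage n)

  lower-relations-all : ∀ n → LowerRelations (suc n)
  lower-relations-all n = Transition.lower (Stage.transition (stage n))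

parity-split : ∀ s → (∃ λ q → s ≡ q * 2) ⊎ (∃ λ q → s ≡ 1 + q * 2)
parity-split zero = inj₁ (0 , refl)
parity-split (suc s) with parity-split s
... | inj₁ (q , e) = inj₂ (q , cong suc e)
... | inj₂ (q , e) = inj₁ (suc q , cong suc e)

Λ-even : ∀ F p i j q → p + i + j ≡ q * 2 → Λ F p i j ≡ 0
Λ-even F p i j q e with (p + i + j) % 2 | trans (cong (_% 2) e) (m*n%n≡0 q 2)
... | .0 | refl = refl

Λ-odd : ∀ F p i j q → p + i + j ≡ 1 + q * 2 → Λ F p i j ≡ F (suc q) (i + j + 2) (j + 1)
Λ-odd F p i j q e with (p + i + j) % 2 | trans (cong (_% 2) e) ([m+kn]%n≡m%n 1 q 2)
... | .1 | refl = cong (λ x → F x (i + j + 2) (j + 1)) half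
  where
    half : (p + i + j + 1) / 2 ≡ suc q
    half = trans (cong (λ x → (x + 1) / 2) e) (trans (cong (λ x → suc x / 2) (+-comm (q * 2) 1)) (m*n/n≡m (suc q) 2))

window-parity : ∀ p i j → (p + i + (j + 2) ≡ 2 + (p + i + j)) × (p + (i + 1) + (j + 1) ≡ 2 + (p + i + j)) ×
                          (p + (i + 2) + j ≡ 2 + (p + i + j))
window-parity p i j = shift₁ p i j , shift₂ p i j , shift₃ p i j
  where
    shift₁ : ∀ p i j → p + i + (j + 2) ≡ 2 + (p + i + j)
    shift₁ = ℕ-Solver.solve-∀
    shift₂ : ∀ p i j → p + (i + 1) + (j + 1) ≡ 2 + (p + i + j)
    shift₂ = ℕ-Solver.solve-∀
    shift₃ : ∀ p i j → p + (i + 2) + j ≡ 2 + (p + i + j)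
    shift₃ = ℕ-Solver.solve-∀

window-rows : ∀ i j → (i + (j + 2) + 2 ≡ 4 + (i + j)) × (i + 1 + (j + 1) + 2 ≡ 4 + (i + j)) × (i + 2 + j + 2 ≡ 4 + (i + j))
window-rows i j = row₁ i j , row₂ i j , row₃ i j
  where
    row₁ : ∀ i j → i + (j + 2) + 2 ≡ 4 + (i + j)
    row₁ = ℕ-Solver.solve-∀
    row₂ : ∀ i j → i + 1 + (j + 1) + 2 ≡ 4 + (i + j)
    row₂ = ℕ-Solver.solve-∀
    row₃ : ∀ i j → i + 2 + j + 2 ≡ 4 + (i + j)
    row₃ = ℕ-Solver.solve-∀

window-columns : ∀ j → (j + 2 + 1 ≡ 3 + j) × (j + 1 + 1 ≡ 2 + j)
window-columns j = column₁ j , column₂ j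
  where
    column₁ : ∀ j → j + 2 + 1 ≡ 3 + j
    column₁ = ℕ-Solver.solve-∀
    column₂ : ∀ j → j + 1 + 1 ≡ 2 + j
    column₂ = ℕ-Solver.solve-∀

Λ-window-even : ∀ F p i j q → p + i + j ≡ q * 2 →
                Poupard (+ Λ F p i (j + 2)) (+ Λ F p (i + 1) (j + 1)) (+ Λ F p (i + 2) j) (+ Λ F p i j)
Λ-window-even F p i j q even with window-parity p i j
... | s₁ , s₂ , s₃ = poupard-zeros (vanish i (j + 2) (suc q) (trans s₁ (cong (λ x → 2 + x) even)))
                                   (vanish (i + 1) (j + 1) (suc q) (trans s₂ (cong (λ x → 2 + x) even)))
                                   (vanish (i + 2) j (suc q) (trans s₃ (cong (λ x → 2 + x) even))) (vanish i j q even)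
  where
    vanish : ∀ i′ j′ q′ → p + i′ + j′ ≡ q′ * 2 → + Λ F p i′ j′ ≡ 0ℤ
    vanish i′ j′ q′ e = cong (λ x → + x) (Λ-even F p i′ j′ q′ e)

Λ-window-odd : ∀ F (isΔ : IsDeltaSequence F) p i j q → p + i + j ≡ 1 + q * 2 →
               Delta.Lower.Horizontal F isΔ (suc q) (suc j) (2 + (i + j)) →
               Poupard (+ Λ F p i (j + 2)) (+ Λ F p (i + 1) (j + 1)) (+ Λ F p (i + 2) j) (+ Λ F p i j)
Λ-window-odd F isΔ p i j q odd with window-parity p i j | window-rows i j | window-columns j
... | s₁ , s₂ , s₃ | r₁ , r₂ , r₃ | c₁ , c₂ =
  poupard-cong (entry i (j + 2) (suc q) (trans s₁ (cong (λ x → 2 + x) odd)) r₁ c₁)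
               (entry (i + 1) (j + 1) (suc q) (trans s₂ (cong (λ x → 2 + x) odd)) r₂ c₂)
               (entry (i + 2) j (suc q) (trans s₃ (cong (λ x → 2 + x) odd)) r₃ (+-comm j 1))
               (entry i j q odd (+-comm (i + j) 2) (+-comm j 1))
  where
    open Delta F isΔ using (f; f-of-F)
    entry : ∀ i′ j′ q′ {m k} → p + i′ + j′ ≡ 1 + q′ * 2 → i′ + j′ + 2 ≡ m → j′ + 1 ≡ k → + Λ F p i′ j′ ≡ f (suc q′) m k
    entry i′ j′ q′ e em ek =
      trans (cong (λ x → + x) (Λ-odd F p i′ j′ q′ e)) (trans (f-of-F _ _ _) (cong₂ (f (suc q′)) em ek))

proposition9p3 : (F : ℕ → ℕ → ℕ → ℕ) → IsDeltaSequence F →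
                 ∀ (p : ℕ) → IsPoupard (Λ F p)
proposition9p3 F isΔ p i j with parity-split (p + i + j)
... | inj₁ (q , even) = poupard-unexpand (Λ-window-even F p i j q even)
... | inj₂ (q , odd)  = poupard-unexpand (Λ-window-odd F isΔ p i j q odd
                          (Delta.lower-relations-all F isΔ q (suc j) (2 + (i + j)) (s≤s z≤n) (s≤s (s≤s (m≤n+m j i)))))
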